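{- Every sum indecomposable permutation of length at least $5$ that does not lie in $K^{(1)}$ has at least one sum indecomposable child that does not lie in $K^{(1)}$.
   Context: A nonempty permutation is sum indecomposable if it is not of the form $\alpha\oplus\beta$ with $\alpha,\beta$ nonempty, where $(\alpha\oplus\beta)(i)=\alpha(i)$ for $i\le|\alpha|$ and $\beta(i-|\alpha|)+|\alpha|$ otherwise. For an entry $x$ of $\pi$, the child $\pi-x$ is the permutation order isomorphic to $\pi$ with $x$ deleted. $K(\pi)$ is the set of sum indecomposable children of $\pi$, and $K^{(m)}$ is the set of sum indecomposable permutations $\pi$ with $|K(\pi)|\le m$. -}

module Defs where

open import Data.Nat using (ℕ; zero; suc; _<_; _≤_)
open import Data.Fin using (Fin; toℕ; punchIn; punchOut)
open import Data.Fin.Properties using (punchInᵢ≢i; punchIn-injective; punchOut-injective)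
open import Data.Product using (Σ; ∃; _×_; _,_; proj₁; proj₂)
open import Function using (_∘_)
open import Function.Definitions using (Injective)
open import Relation.Binary.PropositionalEquality using (_≡_; _≢_; sym)
open import Relation.Nullary using (¬_)
open import Data.Unit using (⊤)

-- A permutation of length n: an injective (hence bijective) map
-- from positions {0..n-1} to values {0..n-1}; π(i) is the entry at position i.
Perm : ℕ → Set
Perm n = Σ (Fin n → Fin n) (Injective _≡_ _≡_)

_≈ₚ_ : ∀ {n} → Perm n → Perm n → Set
_≈ₚ_ {n} σ τ = ∀ (j : Fin n) → proj₁ σ j ≡ proj₁ τ j

-- π = α ⊕ β with |α| = k, 0 < k < n: exactly when the first k positions
-- carry the k smallest values (and then α, β are determined by π).
SplitsAt : ∀ {n} → Perm n → ℕ → Set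
SplitsAt {n} π k = ∀ (j : Fin n) → toℕ j < k → toℕ (proj₁ π j) < k

SumDecomposable : ∀ {n} → Perm n → Set
SumDecomposable {n} π = ∃ λ k → (0 < k) × (k < n) × SplitsAt π k

SumIndecomposable : ∀ {n} → Perm n → Set
SumIndecomposable {n} π = (0 < n) × ¬ SumDecomposable π

-- The child π - x, where x is the entry at position i: delete it and
-- standardize (order isomorphic to the remaining entries).
childFun : ∀ {n} → Perm (suc n) → Fin (suc n) → Fin n → Fin n
childFun (f , inj) i j =
  punchOut {i = f i} {j = f (punchIn i j)} (punchInᵢ≢i i j ∘ inj ∘ sym)

childInj : ∀ {n} (π : Perm (suc n)) (i : Fin (suc n)) → Injective _≡_ _≡_ (childFun π i)
childInj (f , inj) i {j} {k} eq =
  punchIn-injective i j k (inj (punchOut-injective (punchInᵢ≢i i j ∘ inj ∘ sym) (punchInᵢ≢i i k ∘ inj ∘ sym) eq))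

child : ∀ {n} → Perm (suc n) → Fin (suc n) → Perm n
child π i = childFun π i , childInj π i

_∈K_ : ∀ {n} → Perm n → Perm (suc n) → Set
σ ∈K π = SumIndecomposable σ × ∃ λ i → child π i ≈ₚ σ

AtMostOneK : ∀ {n} → Perm (suc n) → Set
AtMostOneK {n} π = ∀ (σ τ : Perm n) → σ ∈K π → τ ∈K π → σ ≈ₚ τ

InK1 : ∀ {n} → Perm n → Set
InK1 {zero} π = SumIndecomposable π × ⊤
InK1 {suc n} π = SumIndecomposable π × AtMostOneK π

module Submission where

-- A sum indecomposable
-- permutation of length at least 2 with at most one sum indecomposable child is m … 2 1, 2 3 … m 1 or
-- m 1 2 … (m − 1): among the children deleting the first entry, the last entry, the minimum and the
-- maximum some pair is indecomposable, and two equal children at positions i < j force the entries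
-- from i to j to run through consecutive values.  So if π is sum indecomposable of length at least 5
-- and all its indecomposable children lie in K⁽¹⁾, each of them has one of these three shapes.
-- Children of equal shape are equal; a decreasing child excludes the other shapes, which contain an
-- increasing triple; and the two cycles occur together only as the outer children of
-- π = m 2 3 … (m − 1) 1, whose second child is indecomposable of no shape.  Hence π ∈ K⁽¹⁾, and as
-- membership in K⁽¹⁾ is decidable, a child as required is found by search.

open import Defs
open import Data.Nat using (ℕ; zero; suc; _+_; _∸_; _<_; _≤_; z≤n; s≤s; s≤s⁻¹; _<?_; _≤?_; _≟_)
open import Data.Nat.Properties
open import Data.Fin using (Fin; toℕ; fromℕ<; punchIn; punchOut) renaming (zero to fzero; suc to fsuc)
open import Data.Fin.Properties using (toℕ-fromℕ<; fromℕ<-toℕ; toℕ<n; toℕ-injective; pigeonhole; any?)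
open import Data.Product using (∃; _×_; _,_; proj₁; proj₂)
open import Data.Sum using (_⊎_; inj₁; inj₂)
open import Data.Empty using (⊥; ⊥-elim)
open import Function using (_∘_)
open import Relation.Binary.Definitions using (tri<; tri≈; tri>)
open import Relation.Binary.PropositionalEquality using (_≡_; _≢_; refl; sym; trans; cong; cong₂; subst; subst₂; module ≡-Reasoning)
open import Relation.Nullary using (¬_; Dec; yes; no)
open import Relation.Nullary.Decidable using (_×-dec_; ¬?; _→-dec_; map′; decidable-stable)
open import Relation.Nullary.Negation using (DoubleNegation)

open ≡-Reasoning

punchInℕ : ℕ → ℕ → ℕ
punchInℕ zero    j       = suc j
punchInℕ (suc i) zero    = zero
punchInℕ (suc i) (suc j) = suc (punchInℕ i j)

punchOutℕ : ℕ → ℕ → ℕ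
punchOutℕ zero    zero    = zero
punchOutℕ zero    (suc j) = j
punchOutℕ (suc i) zero    = zero
punchOutℕ (suc i) (suc j) = suc (punchOutℕ i j)

toℕ-punchIn : ∀ {n} (i : Fin (suc n)) (j : Fin n) → toℕ (punchIn i j) ≡ punchInℕ (toℕ i) (toℕ j)
toℕ-punchIn fzero    j        = refl
toℕ-punchIn (fsuc i) fzero    = refl
toℕ-punchIn (fsuc i) (fsuc j) = cong suc (toℕ-punchIn i j)

toℕ-punchOut : ∀ {n} {i j : Fin (suc n)} (i≢j : i ≢ j) → toℕ (punchOut i≢j) ≡ punchOutℕ (toℕ i) (toℕ j)
toℕ-punchOut {_}     {fzero}  {fzero}  i≢j = ⊥-elim (i≢j refl)
toℕ-punchOut {_}     {fzero}  {fsuc j} i≢j = refl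
toℕ-punchOut {suc _} {fsuc i} {fzero}  i≢j = refl
toℕ-punchOut {suc _} {fsuc i} {fsuc j} i≢j = cong suc (toℕ-punchOut (i≢j ∘ cong fsuc))

punchInℕ-< : ∀ i j → j < i → punchInℕ i j ≡ j
punchInℕ-< (suc i) zero    _         = refl
punchInℕ-< (suc i) (suc j) (s≤s j<i) = cong suc (punchInℕ-< i j j<i)

punchInℕ-≥ : ∀ i j → i ≤ j → punchInℕ i j ≡ suc j
punchInℕ-≥ zero    j       _         = refl
punchInℕ-≥ (suc i) (suc j) (s≤s i≤j) = cong suc (punchInℕ-≥ i j i≤j)

punchInℕ-≤ : ∀ i j → punchInℕ i j ≤ suc j
punchInℕ-≤ zero    j       = ≤-refl
punchInℕ-≤ (suc i) zero    = z≤n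
punchInℕ-≤ (suc i) (suc j) = s≤s (punchInℕ-≤ i j)

punchInℕᵢ≢i : ∀ i j → punchInℕ i j ≢ i
punchInℕᵢ≢i (suc i) (suc j) eq = punchInℕᵢ≢i i j (suc-injective eq)

punchInℕ-injective : ∀ i j k → punchInℕ i j ≡ punchInℕ i k → j ≡ k
punchInℕ-injective zero    j       k       eq = suc-injective eq
punchInℕ-injective (suc i) zero    zero    eq = refl
punchInℕ-injective (suc i) (suc j) (suc k) eq = cong suc (punchInℕ-injective i j k (suc-injective eq))

punchOutℕ-< : ∀ v w → w < v → punchOutℕ v w ≡ w
punchOutℕ-< (suc v) zero    _         = refl
punchOutℕ-< (suc v) (suc w) (s≤s w<v) = cong suc (punchOutℕ-< v w w<v)

punchOutℕ-> : ∀ v w → v < w → suc (punchOutℕ v w) ≡ w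
punchOutℕ-> zero    (suc w) _         = refl
punchOutℕ-> (suc v) (suc w) (s≤s v<w) = cong suc (punchOutℕ-> v w v<w)

punchOutℕ-≤ : ∀ v w → punchOutℕ v w ≤ w
punchOutℕ-≤ zero    zero    = z≤n
punchOutℕ-≤ zero    (suc w) = n≤1+n w
punchOutℕ-≤ (suc v) zero    = z≤n
punchOutℕ-≤ (suc v) (suc w) = s≤s (punchOutℕ-≤ v w)

punchInℕ-punchOutℕ : ∀ x j → j ≢ x → punchInℕ x (punchOutℕ x j) ≡ j
punchInℕ-punchOutℕ zero    zero    j≢x = ⊥-elim (j≢x refl)
punchInℕ-punchOutℕ zero    (suc j) j≢x = refl
punchInℕ-punchOutℕ (suc x) zero    j≢x = refl
punchInℕ-punchOutℕ (suc x) (suc j) j≢x = cong suc (punchInℕ-punchOutℕ x j (j≢x ∘ cong suc))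

data PunchOutView (v w : ℕ) : Set where
  below : w < v → punchOutℕ v w ≡ w → PunchOutView v w
  above : v < w → suc (punchOutℕ v w) ≡ w → PunchOutView v w

punchOutView : ∀ v w → w ≢ v → PunchOutView v w
punchOutView v w w≢v with <-cmp w v
... | tri< w<v _ _ = below w<v (punchOutℕ-< v w w<v)
... | tri≈ _ w≡v _ = ⊥-elim (w≢v w≡v)
... | tri> _ _ v<w = above v<w (punchOutℕ-> v w v<w)

punchOutℕ-mono-≤ : ∀ v {a b} → a ≤ b → punchOutℕ v a ≤ punchOutℕ v b
punchOutℕ-mono-≤ zero    {zero}  {b}     _         = z≤n
punchOutℕ-mono-≤ zero    {suc a} {suc b} (s≤s a≤b) = a≤b
punchOutℕ-mono-≤ (suc v) {zero}  {b}     _         = z≤n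
punchOutℕ-mono-≤ (suc v) {suc a} {suc b} (s≤s a≤b) = s≤s (punchOutℕ-mono-≤ v a≤b)

punchOutℕ-bounded : ∀ n v w → v < suc n → w < suc n → w ≢ v → punchOutℕ v w < n
punchOutℕ-bounded n v w v<1+n w<1+n w≢v with punchOutView v w w≢v
... | below w<v eq = subst (_< n) (sym eq) (<-≤-trans w<v (s≤s⁻¹ v<1+n))
... | above _   eq = s≤s⁻¹ (subst (_< suc n) (sym eq) w<1+n)

punchOutℕ-injective : ∀ v a b → a ≢ v → b ≢ v → punchOutℕ v a ≡ punchOutℕ v b → a ≡ b
punchOutℕ-injective v a b a≢v b≢v eq with punchOutView v a a≢v | punchOutView v b b≢v
... | below _ ea | below _ eb = trans (sym ea) (trans eq eb)
... | above _ ea | above _ eb = trans (sym ea) (trans (cong suc eq) eb)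
... | below a<v ea | above v<b eb =
  ⊥-elim (<⇒≱ a<v (s≤s⁻¹ (subst (v <_) (trans (sym eb) (cong suc (trans (sym eq) ea))) v<b)))
... | above v<a ea | below b<v eb =
  ⊥-elim (<⇒≱ b<v (s≤s⁻¹ (subst (v <_) (trans (sym ea) (cong suc (trans eq eb))) v<a)))

punchOutℕ-mono-< : ∀ v {a b} → a ≢ v → b ≢ v → a < b → punchOutℕ v a < punchOutℕ v b
punchOutℕ-mono-< v {a} {b} a≢v b≢v a<b with m≤n⇒m<n∨m≡n (punchOutℕ-mono-≤ v (<⇒≤ a<b))
... | inj₁ lt = lt
... | inj₂ eq = ⊥-elim (<-irrefl (punchOutℕ-injective v a b a≢v b≢v eq) a<b)

punchOutℕ-cancel-< : ∀ v {a b} → punchOutℕ v a < punchOutℕ v b → a < b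
punchOutℕ-cancel-< v {a} {b} lt = ≰⇒> λ b≤a → <⇒≱ lt (punchOutℕ-mono-≤ v b≤a)

punchOutℕ-≡-self : ∀ v w → w ≢ v → punchOutℕ v w ≡ v → w ≡ suc v
punchOutℕ-≡-self v w w≢v eq with punchOutView v w w≢v
... | below _ eq′ = ⊥-elim (w≢v (trans (sym eq′) eq))
... | above _ eq′ = trans (sym eq′) (cong suc eq)

punchOutℕ-≡-pred : ∀ v w → w ≢ v → suc (punchOutℕ v w) ≡ v → suc w ≡ v
punchOutℕ-≡-pred v w w≢v eq with punchOutView v w w≢v
... | below _ eq′ = trans (cong suc (sym eq′)) eq
... | above _ eq′ = ⊥-elim (w≢v (trans (sym eq′) eq))

punchInℕ-mono-< : ∀ i {j k} → j < k → punchInℕ i j < punchInℕ i k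
punchInℕ-mono-< zero    j<k = s≤s j<k
punchInℕ-mono-< (suc i) {zero}  {suc k} _         = s≤s z≤n
punchInℕ-mono-< (suc i) {suc j} {suc k} (s≤s j<k) = s≤s (punchInℕ-mono-< i j<k)

punchOutℕ-positive : ∀ b t → 0 < b → 0 < t → t ≢ b → 0 < punchOutℕ b t
punchOutℕ-positive b t 0<b 0<t t≢b with punchOutView b t t≢b
... | below _   eq = subst (0 <_) (sym eq) 0<t
... | above b<t eq = <-≤-trans 0<b (s≤s⁻¹ (subst (b <_) (sym eq) b<t))

IsPermOn : ℕ → (ℕ → ℕ) → Set
IsPermOn m F = (∀ t → t < m → F t < m) × (∀ s t → s < m → t < m → F s ≡ F t → s ≡ t)

SplitsAtℕ : (ℕ → ℕ) → ℕ → Set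
SplitsAtℕ F k = ∀ j → j < k → F j < k

IndecomposableOn : ℕ → (ℕ → ℕ) → Set
IndecomposableOn m F = ∀ k → 0 < k → k < m → ¬ SplitsAtℕ F k

childℕ : (ℕ → ℕ) → ℕ → ℕ → ℕ
childℕ F x t = punchOutℕ (F x) (F (punchInℕ x t))

EqualBelow : ℕ → (ℕ → ℕ) → (ℕ → ℕ) → Set
EqualBelow m F G = ∀ t → t < m → F t ≡ G t

AtMostOneIndecomposableChild : ℕ → (ℕ → ℕ) → Set
AtMostOneIndecomposableChild n F = ∀ x y → x < suc n → y < suc n →
  IndecomposableOn n (childℕ F x) → IndecomposableOn n (childℕ F y) → EqualBelow n (childℕ F x) (childℕ F y)

EqualBelow-sym : ∀ {m F G} → EqualBelow m F G → EqualBelow m G F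
EqualBelow-sym F≡G t t<m = sym (F≡G t t<m)

EqualBelow-trans : ∀ {m F G H} → EqualBelow m F G → EqualBelow m G H → EqualBelow m F H
EqualBelow-trans F≡G G≡H t t<m = trans (F≡G t t<m) (G≡H t t<m)

IndecomposableOn-cong : ∀ {m F G} → EqualBelow m F G → IndecomposableOn m F → IndecomposableOn m G
IndecomposableOn-cong F≡G indF k 0<k k<m splitG =
  indF k 0<k k<m λ j j<k → subst (_< k) (sym (F≡G j (<-trans j<k k<m))) (splitG j j<k)

childℕ-cong : ∀ {n F G} x → EqualBelow (suc n) F G → x < suc n → EqualBelow n (childℕ F x) (childℕ G x)
childℕ-cong x F≡G x<1+n t t<n =
  cong₂ punchOutℕ (F≡G x x<1+n) (F≡G (punchInℕ x t) (s≤s (≤-trans (punchInℕ-≤ x t) t<n)))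

AtMostOneIndecomposableChild-cong : ∀ {n F G} → EqualBelow (suc n) F G →
  AtMostOneIndecomposableChild n F → AtMostOneIndecomposableChild n G
AtMostOneIndecomposableChild-cong F≡G uniqueF x y x<1+n y<1+n indGx indGy =
  EqualBelow-trans (EqualBelow-sym (childℕ-cong x F≡G x<1+n))
    (EqualBelow-trans (uniqueF x y x<1+n y<1+n (IndecomposableOn-cong (EqualBelow-sym (childℕ-cong x F≡G x<1+n)) indGx)
                                              (IndecomposableOn-cong (EqualBelow-sym (childℕ-cong y F≡G y<1+n)) indGy))
                      (childℕ-cong y F≡G y<1+n))

childℕ-isPerm : ∀ n F x → IsPermOn (suc n) F → x < suc n → IsPermOn n (childℕ F x)
childℕ-isPerm n F x (bounded , injective) x<1+n = childBounded , childInjective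
  where
  inRange : ∀ t → t < n → punchInℕ x t < suc n
  inRange t t<n = s≤s (≤-trans (punchInℕ-≤ x t) t<n)
  avoidsDeleted : ∀ t → t < n → F (punchInℕ x t) ≢ F x
  avoidsDeleted t t<n eq = punchInℕᵢ≢i x t (injective _ _ (inRange t t<n) x<1+n eq)
  childBounded : ∀ t → t < n → childℕ F x t < n
  childBounded t t<n = punchOutℕ-bounded n (F x) _ (bounded x x<1+n) (bounded _ (inRange t t<n)) (avoidsDeleted t t<n)
  childInjective : ∀ s t → s < n → t < n → childℕ F x s ≡ childℕ F x t → s ≡ t
  childInjective s t s<n t<n eq = punchInℕ-injective x s t (injective _ _ (inRange s s<n) (inRange t t<n)
    (punchOutℕ-injective (F x) _ _ (avoidsDeleted s s<n) (avoidsDeleted t t<n) eq))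

childℕ-punchOutℕ : ∀ F x j → j ≢ x → childℕ F x (punchOutℕ x j) ≡ punchOutℕ (F x) (F j)
childℕ-punchOutℕ F x j j≢x = cong (λ z → punchOutℕ (F x) (F z)) (punchInℕ-punchOutℕ x j j≢x)

pigeonholeℕ : ∀ {A B} → B < A → (h : ℕ → ℕ) → (∀ t → t < A → h t < B) →
              ¬ (∀ s t → s < A → t < A → h s ≡ h t → s ≡ t)
pigeonholeℕ B<A h bounded injective with pigeonhole B<A (λ i → fromℕ< (bounded (toℕ i) (toℕ<n i)))
... | i , j , i<j , eq = <-irrefl (injective (toℕ i) (toℕ j) (toℕ<n i) (toℕ<n j) hi≡hj) i<j
  where
  hi≡hj : h (toℕ i) ≡ h (toℕ j)
  hi≡hj = trans (sym (toℕ-fromℕ< (bounded (toℕ i) (toℕ<n i))))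
            (trans (cong toℕ eq) (toℕ-fromℕ< (bounded (toℕ j) (toℕ<n j))))

¬¬-surjective : ∀ n F → IsPermOn (suc n) F → ∀ v → v < suc n → DoubleNegation (∃ λ t → t < suc n × F t ≡ v)
¬¬-surjective n F (bounded , injective) v v<1+n missed =
  pigeonholeℕ ≤-refl (λ t → punchOutℕ v (F t))
    (λ t t<1+n → punchOutℕ-bounded n v (F t) v<1+n (bounded t t<1+n) (λ eq → missed (t , t<1+n , eq)))
    (λ s t s<1+n t<1+n eq → injective s t s<1+n t<1+n
      (punchOutℕ-injective v (F s) (F t) (λ e → missed (s , s<1+n , e)) (λ e → missed (t , t<1+n , e)) eq))

entries : ∀ {N} → Perm N → ℕ → ℕ
entries {N} (f , _) t with t <? N
... | yes t<N = toℕ (f (fromℕ< t<N))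
... | no  _   = 0

entries-toℕ : ∀ {N} (π : Perm N) (j : Fin N) → entries π (toℕ j) ≡ toℕ (proj₁ π j)
entries-toℕ {N} (f , _) j with toℕ j <? N
... | yes j<N = cong (toℕ ∘ f) (fromℕ<-toℕ j j<N)
... | no  j≮N = ⊥-elim (j≮N (toℕ<n j))

entries-fromℕ< : ∀ {N} (π : Perm N) t (t<N : t < N) → entries π t ≡ toℕ (proj₁ π (fromℕ< t<N))
entries-fromℕ< π t t<N = trans (cong (entries π) (sym (toℕ-fromℕ< t<N))) (entries-toℕ π (fromℕ< t<N))

entries-isPerm : ∀ {N} (π : Perm N) → IsPermOn N (entries π)
entries-isPerm {N} π = bounded , injective
  where
  bounded : ∀ t → t < N → entries π t < N
  bounded t t<N = subst (_< N) (sym (entries-fromℕ< π t t<N)) (toℕ<n _)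
  injective : ∀ s t → s < N → t < N → entries π s ≡ entries π t → s ≡ t
  injective s t s<N t<N eq = trans (sym (toℕ-fromℕ< s<N)) (trans (cong toℕ positions≡) (toℕ-fromℕ< t<N))
    where
    positions≡ : fromℕ< s<N ≡ fromℕ< t<N
    positions≡ = proj₂ π (toℕ-injective (trans (sym (entries-fromℕ< π s s<N)) (trans eq (entries-fromℕ< π t t<N))))

entries-≈ : ∀ {m} (σ τ : Perm m) → σ ≈ₚ τ → EqualBelow m (entries σ) (entries τ)
entries-≈ σ τ σ≈τ t t<m = trans (entries-fromℕ< σ t t<m) (trans (cong toℕ (σ≈τ _)) (sym (entries-fromℕ< τ t t<m)))

entries-child : ∀ {n} (π : Perm (suc n)) (i : Fin (suc n)) → EqualBelow n (entries (child π i)) (childℕ (entries π) (toℕ i))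
entries-child {n} π i t t<n =
  trans (entries-fromℕ< (child π i) t t<n)
   (trans (toℕ-punchOut {i = proj₁ π i} {j = proj₁ π (punchIn i j)} _)
     (cong₂ punchOutℕ (sym (entries-toℕ π i))
       (trans (sym (entries-toℕ π (punchIn i j)))
              (cong (entries π) (trans (toℕ-punchIn i j) (cong (punchInℕ (toℕ i)) (toℕ-fromℕ< t<n)))))))
  where
  j = fromℕ< t<n

entries-child-fromℕ< : ∀ {n} (π : Perm (suc n)) x (x<1+n : x < suc n) →
  EqualBelow n (entries (child π (fromℕ< x<1+n))) (childℕ (entries π) x)
entries-child-fromℕ< π x x<1+n t t<n =
  trans (entries-child π (fromℕ< x<1+n) t t<n) (cong (λ z → childℕ (entries π) z t) (toℕ-fromℕ< x<1+n))

SumIndecomposable⇒IndecomposableOn : ∀ {N} (π : Perm N) → SumIndecomposable π → IndecomposableOn N (entries π)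
SumIndecomposable⇒IndecomposableOn π (_ , indecomposable) k 0<k k<N splits =
  indecomposable (k , 0<k , k<N , λ j j<k → subst (_< k) (entries-toℕ π j) (splits (toℕ j) j<k))

IndecomposableOn⇒SumIndecomposable : ∀ {N} (π : Perm N) → 0 < N → IndecomposableOn N (entries π) → SumIndecomposable π
IndecomposableOn⇒SumIndecomposable π 0<N indecomposable = 0<N , λ { (k , 0<k , k<N , splits) →
  indecomposable k 0<k k<N λ j j<k → let j<N = <-trans j<k k<N in
    subst (_< k) (sym (entries-fromℕ< π j j<N)) (splits (fromℕ< j<N) (subst (_< k) (sym (toℕ-fromℕ< j<N)) j<k)) }

AtMostOneIndecomposableChild⇒AtMostOneK : ∀ {m} (ρ : Perm (suc m)) →
  AtMostOneIndecomposableChild m (entries ρ) → AtMostOneK ρ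
AtMostOneIndecomposableChild⇒AtMostOneK {m} ρ unique σ τ (indσ , a , ρa≈σ) (indτ , b , ρb≈τ) j =
  toℕ-injective (trans (sym (entries-toℕ σ j))
    (trans (sym (childA≡σ _ (toℕ<n j)))
      (trans (unique (toℕ a) (toℕ b) (toℕ<n a) (toℕ<n b) indA indB (toℕ j) (toℕ<n j))
        (trans (childB≡τ _ (toℕ<n j)) (entries-toℕ τ j)))))
  where
  childA≡σ : EqualBelow m (childℕ (entries ρ) (toℕ a)) (entries σ)
  childA≡σ = EqualBelow-trans (EqualBelow-sym (entries-child ρ a)) (entries-≈ (child ρ a) σ ρa≈σ)
  childB≡τ : EqualBelow m (childℕ (entries ρ) (toℕ b)) (entries τ)
  childB≡τ = EqualBelow-trans (EqualBelow-sym (entries-child ρ b)) (entries-≈ (child ρ b) τ ρb≈τ)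
  indA = IndecomposableOn-cong (EqualBelow-sym childA≡σ) (SumIndecomposable⇒IndecomposableOn σ indσ)
  indB = IndecomposableOn-cong (EqualBelow-sym childB≡τ) (SumIndecomposable⇒IndecomposableOn τ indτ)

AtMostOneK⇒AtMostOneIndecomposableChild : ∀ {m} (ρ : Perm (suc m)) →
  AtMostOneK ρ → AtMostOneIndecomposableChild m (entries ρ)
AtMostOneK⇒AtMostOneIndecomposableChild {m} ρ unique x y x<1+m y<1+m indX indY t t<m =
  trans (sym (childX t t<m)) (trans (entries-≈ (child ρ xf) (child ρ yf) childX≈childY t t<m) (childY t t<m))
  where
  xf = fromℕ< x<1+m
  yf = fromℕ< y<1+m
  childX = entries-child-fromℕ< ρ x x<1+m
  childY = entries-child-fromℕ< ρ y y<1+m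
  0<m = ≤-<-trans z≤n t<m
  childX≈childY : child ρ xf ≈ₚ child ρ yf
  childX≈childY = unique (child ρ xf) (child ρ yf)
    (IndecomposableOn⇒SumIndecomposable (child ρ xf) 0<m (IndecomposableOn-cong (EqualBelow-sym childX) indX) , xf , λ _ → refl)
    (IndecomposableOn⇒SumIndecomposable (child ρ yf) 0<m (IndecomposableOn-cong (EqualBelow-sym childY) indY) , yf , λ _ → refl)

splitsAtℕ? : ∀ F k → Dec (SplitsAtℕ F k)
splitsAtℕ? F k = map′ (λ below j → below {j}) (λ below {j} → below j) (allUpTo? (λ j → F j <? k) k)

indecomposableOn? : ∀ m F → Dec (IndecomposableOn m F)
indecomposableOn? m F = map′ (λ ind k 0<k k<m → ind {k} k<m 0<k) (λ ind {k} k<m 0<k → ind k 0<k k<m)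
  (allUpTo? (λ k → (0 <? k) →-dec ¬? (splitsAtℕ? F k)) m)

equalBelow? : ∀ m F G → Dec (EqualBelow m F G)
equalBelow? m F G = map′ (λ eq t → eq {t}) (λ eq {t} → eq t) (allUpTo? (λ t → F t ≟ G t) m)

atMostOneIndecomposableChild? : ∀ n F → Dec (AtMostOneIndecomposableChild n F)
atMostOneIndecomposableChild? n F =
  map′ (λ unique x y x<1+n y<1+n → unique {x} x<1+n {y} y<1+n) (λ unique {x} x<1+n {y} y<1+n → unique x y x<1+n y<1+n)
    (allUpTo? (λ x → allUpTo? (λ y → indecomposableOn? n (childℕ F x) →-dec
                                       (indecomposableOn? n (childℕ F y) →-dec equalBelow? n (childℕ F x) (childℕ F y)))
                                (suc n))
              (suc n))

sumIndecomposable? : ∀ {m} (σ : Perm m) → Dec (SumIndecomposable σ)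
sumIndecomposable? {m} σ = map′ (λ (0<m , ind) → IndecomposableOn⇒SumIndecomposable σ 0<m ind)
  (λ ind → proj₁ ind , SumIndecomposable⇒IndecomposableOn σ ind) ((0 <? m) ×-dec indecomposableOn? m (entries σ))

inK1? : ∀ {m} (ρ : Perm (suc m)) → Dec (InK1 ρ)
inK1? {m} ρ = sumIndecomposable? ρ ×-dec
  map′ (AtMostOneIndecomposableChild⇒AtMostOneK ρ) (AtMostOneK⇒AtMostOneIndecomposableChild ρ) (atMostOneIndecomposableChild? m (entries ρ))

-- Crossings and indecomposable children

splitsAtℕ⇒≥ : ∀ m c → IsPermOn m c → ∀ k l → k ≤ l → l < m → SplitsAtℕ c k → k ≤ c l
splitsAtℕ⇒≥ m c (_ , injective) k l k≤l l<m splits = ≮⇒≥ λ cl<k → pigeonholeℕ ≤-refl h (bounded cl<k) injectiveH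
  where
  h : ℕ → ℕ
  h zero    = c l
  h (suc t) = c t
  bounded : c l < k → ∀ t → t < suc k → h t < k
  bounded cl<k zero    _       = cl<k
  bounded cl<k (suc t) t<1+k = splits t (s≤s⁻¹ t<1+k)
  inRange : ∀ t → t < k → t < m
  inRange t t<k = <-≤-trans t<k (≤-trans k≤l (<⇒≤ l<m))
  l≢ : ∀ t → t < k → c l ≢ c t
  l≢ t t<k eq = <⇒≱ t<k (subst (k ≤_) (injective l t l<m (inRange t t<k) eq) k≤l)
  injectiveH : ∀ s t → s < suc k → t < suc k → h s ≡ h t → s ≡ t
  injectiveH zero    zero    _   _   _  = refl
  injectiveH zero    (suc t) _   t<  eq = ⊥-elim (l≢ t (s≤s⁻¹ t<) eq)
  injectiveH (suc s) zero    s<  _   eq = ⊥-elim (l≢ s (s≤s⁻¹ s<) (sym eq))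
  injectiveH (suc s) (suc t) s<  t<  eq = cong suc (injective s t (inRange s (s≤s⁻¹ s<)) (inRange t (s≤s⁻¹ t<)) eq)

closedAbove⇒splitsAtℕ : ∀ N F → IsPermOn N F → ∀ g → g ≤ N → (∀ l → g ≤ l → l < N → g ≤ F l) → SplitsAtℕ F g
closedAbove⇒splitsAtℕ N F (bounded , injective) g g≤N closed j j<g = ≰⇒> λ g≤Fj →
  pigeonholeℕ ≤-refl (h j) (h-bounded g≤Fj) (h-injective g≤Fj)
  where
  d = N ∸ g
  j<N = <-≤-trans j<g g≤N
  upper : ∀ t → t < d → g + t < N
  upper t t<d = subst (g + t <_) (m+[n∸m]≡n g≤N) (+-monoʳ-< g t<d)
  closed′ : ∀ t → t < d → g ≤ F (g + t)
  closed′ t t<d = closed _ (m≤m+n g t) (upper t t<d)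
  h : ℕ → ℕ → ℕ
  h j zero    = F j ∸ g
  h j (suc t) = F (g + t) ∸ g
  h-bounded : g ≤ F j → ∀ t → t < suc d → h j t < d
  h-bounded g≤Fj zero    _     = ∸-monoˡ-< (bounded j j<N) g≤Fj
  h-bounded g≤Fj (suc t) t<1+d = ∸-monoˡ-< (bounded _ (upper t (s≤s⁻¹ t<1+d))) (closed′ t (s≤s⁻¹ t<1+d))
  j≢ : g ≤ F j → ∀ t → t < d → F j ∸ g ≢ F (g + t) ∸ g
  j≢ g≤Fj t t<d eq =
    <⇒≱ j<g (subst (g ≤_) (sym (injective _ _ j<N (upper t t<d) (∸-cancelʳ-≡ g≤Fj (closed′ t t<d) eq))) (m≤m+n g t))
  h-injective : g ≤ F j → ∀ s t → s < suc d → t < suc d → h j s ≡ h j t → s ≡ t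
  h-injective g≤Fj zero    zero    _  _  _  = refl
  h-injective g≤Fj zero    (suc t) _  t< eq = ⊥-elim (j≢ g≤Fj t (s≤s⁻¹ t<) eq)
  h-injective g≤Fj (suc s) zero    s< _  eq = ⊥-elim (j≢ g≤Fj s (s≤s⁻¹ s<) (sym eq))
  h-injective g≤Fj (suc s) (suc t) s< t< eq = cong suc (+-cancelˡ-≡ g s t
    (injective _ _ (upper s (s≤s⁻¹ s<)) (upper t (s≤s⁻¹ t<))
      (∸-cancelʳ-≡ (closed′ s (s≤s⁻¹ s<)) (closed′ t (s≤s⁻¹ t<)) eq)))

Crossing : ℕ → (ℕ → ℕ) → ℕ → Set
Crossing N F g = ∃ λ j → ∃ λ l → j < g × g ≤ l × l < N × F l < F j

indecomposable⇒¬¬crossing : ∀ N F → IsPermOn N F → IndecomposableOn N F → ∀ g → 0 < g → g < N → DoubleNegation (Crossing N F g)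
indecomposable⇒¬¬crossing N F isPerm indecomposable g 0<g g<N noCrossing =
  indecomposable g 0<g g<N λ j j<g → ≰⇒> λ g≤Fj →
    <⇒≱ (closedAbove⇒splitsAtℕ N F isPerm g (<⇒≤ g<N) (λ l g≤l l<N →
           ≤-trans g≤Fj (≮⇒≥ λ Fl<Fj → noCrossing (j , l , j<g , g≤l , l<N , Fl<Fj))) j j<g) g≤Fj

-- A crossing of the cut k of childℕ F x, in positions of F: the cut sits at k in F when k ≤ x and at k + 1 otherwise.
data SurvivingCrossing (F : ℕ → ℕ) (N x k : ℕ) : Set where
  cutBefore : ∀ j l → k ≤ x → j < k → k ≤ l → l < N → l ≢ x → F l < F j → SurvivingCrossing F N x k
  cutAfter  : ∀ j l → x < k → j ≤ k → k < l → l < N → j ≢ x → F l < F j → SurvivingCrossing F N x k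

punchOutℕ-<-cut : ∀ x j k → j ≢ x → (j < k × k ≤ x) ⊎ (x < k × j ≤ k) → punchOutℕ x j < k
punchOutℕ-<-cut x j k j≢x cut with punchOutView x j j≢x
punchOutℕ-<-cut x j k j≢x (inj₁ (j<k , k≤x)) | below _   eq = subst (_< k) (sym eq) j<k
punchOutℕ-<-cut x j k j≢x (inj₁ (j<k , k≤x)) | above x<j _  = ⊥-elim (<⇒≱ (<-≤-trans j<k k≤x) (<⇒≤ x<j))
punchOutℕ-<-cut x j k j≢x (inj₂ (x<k , j≤k)) | below j<x eq = subst (_< k) (sym eq) (<-trans j<x x<k)
punchOutℕ-<-cut x j k j≢x (inj₂ (x<k , j≤k)) | above _   eq = subst (_≤ k) (sym eq) j≤k

punchOutℕ-≥-cut : ∀ x l k → l ≢ x → (k ≤ l × k ≤ x) ⊎ (x < k × k < l) → k ≤ punchOutℕ x l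
punchOutℕ-≥-cut x l k l≢x cut with punchOutView x l l≢x
punchOutℕ-≥-cut x l k l≢x (inj₁ (k≤l , k≤x)) | below _   eq = subst (k ≤_) (sym eq) k≤l
punchOutℕ-≥-cut x l k l≢x (inj₁ (k≤l , k≤x)) | above x<l eq = ≤-trans k≤x (s≤s⁻¹ (subst (x <_) (sym eq) x<l))
punchOutℕ-≥-cut x l k l≢x (inj₂ (x<k , k<l)) | below l<x _  = ⊥-elim (<⇒≱ (<-trans x<k k<l) (<⇒≤ l<x))
punchOutℕ-≥-cut x l k l≢x (inj₂ (x<k , k<l)) | above _   eq = s≤s⁻¹ (subst (k <_) (sym eq) k<l)

survivingCrossing⇒¬splitsAtℕ : ∀ n F x → IsPermOn (suc n) F → x < suc n → ∀ k →
  SurvivingCrossing F (suc n) x k → ¬ SplitsAtℕ (childℕ F x) k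
survivingCrossing⇒¬splitsAtℕ n F x isPerm@(_ , injective) x<1+n k crossing splits = refute crossing
  where
  inverted : ∀ j l → j < suc n → l < suc n → j ≢ x → l ≢ x → F l < F j →
             punchOutℕ x j < k → k ≤ punchOutℕ x l → ⊥
  inverted j l j<1+n l<1+n j≢x l≢x Fl<Fj j′<k k≤l′ =
    <⇒≱ (<-trans (subst₂ _<_ (sym (childℕ-punchOutℕ F x l l≢x)) (sym (childℕ-punchOutℕ F x j j≢x))
                    (punchOutℕ-mono-< (F x) (l≢x ∘ injective _ _ l<1+n x<1+n) (j≢x ∘ injective _ _ j<1+n x<1+n) Fl<Fj))
                 (splits _ j′<k))
        (splitsAtℕ⇒≥ n (childℕ F x) (childℕ-isPerm n F x isPerm x<1+n) k _ k≤l′ (punchOutℕ-bounded n x l x<1+n l<1+n l≢x) splits)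
  refute : SurvivingCrossing F (suc n) x k → ⊥
  refute (cutBefore j l k≤x j<k k≤l l<1+n l≢x Fl<Fj) =
    inverted j l (<-trans (<-≤-trans j<k k≤l) l<1+n) l<1+n j≢x l≢x Fl<Fj
      (punchOutℕ-<-cut x j k j≢x (inj₁ (j<k , k≤x))) (punchOutℕ-≥-cut x l k l≢x (inj₁ (k≤l , k≤x)))
    where j≢x = λ j≡x → <⇒≱ (<-≤-trans j<k k≤x) (≤-reflexive (sym j≡x))
  refute (cutAfter j l x<k j≤k k<l l<1+n j≢x Fl<Fj) =
    inverted j l (≤-<-trans j≤k (<-trans k<l l<1+n)) l<1+n j≢x l≢x Fl<Fj
      (punchOutℕ-<-cut x j k j≢x (inj₂ (x<k , j≤k))) (punchOutℕ-≥-cut x l k l≢x (inj₂ (x<k , k<l)))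
    where l≢x = λ l≡x → <⇒≱ (<-trans x<k k<l) (≤-reflexive l≡x)

survivingCrossings⇒indecomposable : ∀ n F x → IsPermOn (suc n) F → x < suc n →
  (∀ k → 0 < k → k < n → DoubleNegation (SurvivingCrossing F (suc n) x k)) → IndecomposableOn n (childℕ F x)
survivingCrossings⇒indecomposable n F x isPerm x<1+n crossings k 0<k k<n splits =
  crossings k 0<k k<n λ crossing → survivingCrossing⇒¬splitsAtℕ n F x isPerm x<1+n k crossing splits

¬¬survivingCrossing : ∀ F N x k → (k ≤ x → DoubleNegation (SurvivingCrossing F N x k)) →
  (x < k → DoubleNegation (SurvivingCrossing F N x k)) → DoubleNegation (SurvivingCrossing F N x k)
¬¬survivingCrossing F N x k ifBefore ifAfter with k ≤? x
... | yes k≤x = ifBefore k≤x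
... | no  k≰x = ifAfter (≰⇒> k≰x)

startsAtTop⇒indecomposable : ∀ n c → suc (c 0) ≡ n → IndecomposableOn n c
startsAtTop⇒indecomposable n c c0 k 0<k k<n splits = <⇒≱ (splits 0 0<k) (s≤s⁻¹ (subst (k <_) (sym c0) k<n))

endsAtBottom⇒indecomposable : ∀ n c → IsPermOn (suc n) c → c n ≡ 0 → IndecomposableOn (suc n) c
endsAtBottom⇒indecomposable n c isPerm cn k 0<k k<1+n splits =
  <⇒≱ (subst (_< k) (sym cn) 0<k) (splitsAtℕ⇒≥ (suc n) c isPerm k n (s≤s⁻¹ k<1+n) ≤-refl splits)

childℕ-indecomposable-topFirst : ∀ n F x → IsPermOn (suc n) F → F 0 ≡ n → 0 < x → x < suc n → IndecomposableOn n (childℕ F x)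
childℕ-indecomposable-topFirst n F x (bounded , injective) F0≡n 0<x x<1+n = startsAtTop⇒indecomposable n (childℕ F x)
  (trans (cong (λ z → suc (punchOutℕ (F x) (F z))) (punchInℕ-< x 0 0<x))
    (trans (cong (λ z → suc (punchOutℕ (F x) z)) F0≡n) (punchOutℕ-> (F x) n Fx<n)))
  where
  Fx<n : F x < n
  Fx<n = ≤∧≢⇒< (s≤s⁻¹ (bounded x x<1+n)) λ Fx≡n → <⇒≢ 0<x (injective 0 x (s≤s z≤n) x<1+n (trans F0≡n (sym Fx≡n)))

childℕ-indecomposable-bottomLast : ∀ n F x → IsPermOn (suc (suc n)) F → F (suc n) ≡ 0 → x < suc n →
  IndecomposableOn (suc n) (childℕ F x)
childℕ-indecomposable-bottomLast n F x isPerm@(_ , injective) Fn≡0 x<1+n =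
  endsAtBottom⇒indecomposable n (childℕ F x) (childℕ-isPerm (suc n) F x isPerm (m<n⇒m<1+n x<1+n))
    (trans (cong (λ z → punchOutℕ (F x) (F z)) (punchInℕ-≥ x n (s≤s⁻¹ x<1+n)))
      (trans (cong (punchOutℕ (F x)) Fn≡0) (punchOutℕ-< (F x) 0 0<Fx)))
  where
  0<Fx : 0 < F x
  0<Fx = n≢0⇒n>0 λ Fx≡0 → <⇒≢ x<1+n (injective x (suc n) (m<n⇒m<1+n x<1+n) ≤-refl (trans Fx≡0 (sym Fn≡0)))

-- Equal children and runs of consecutive values

Consecutive : ℕ → ℕ → Set
Consecutive a b = b ≡ suc a ⊎ a ≡ suc b

punchOutℕ-consecutive : ∀ a b → Consecutive a b → ∀ w → w ≢ a → w ≢ b → punchOutℕ a w ≡ punchOutℕ b w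
punchOutℕ-consecutive a b (inj₁ refl) w w≢a w≢b with punchOutView a w w≢a
... | below w<a eq = trans eq (sym (punchOutℕ-< (suc a) w (m<n⇒m<1+n w<a)))
... | above a<w eq = suc-injective (trans eq (sym (punchOutℕ-> (suc a) w (≤∧≢⇒< a<w (w≢b ∘ sym)))))
punchOutℕ-consecutive a b (inj₂ refl) w w≢a w≢b = sym (punchOutℕ-consecutive b a (inj₁ refl) w w≢b w≢a)

punchOutℕ-consecutive-swap : ∀ a b → Consecutive a b → punchOutℕ a b ≡ punchOutℕ b a
punchOutℕ-consecutive-swap a b (inj₁ refl) = trans (suc-injective (punchOutℕ-> a (suc a) ≤-refl)) (sym (punchOutℕ-< (suc a) a ≤-refl))
punchOutℕ-consecutive-swap a b (inj₂ refl) = sym (punchOutℕ-consecutive-swap b a (inj₁ refl))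

childℕ-adjacent-consecutive : ∀ n F i → IsPermOn (suc n) F → suc i < suc n → Consecutive (F i) (F (suc i)) →
  EqualBelow n (childℕ F i) (childℕ F (suc i))
childℕ-adjacent-consecutive n F i (_ , injective) i+1<1+n consecutive t t<n with <-cmp t i
... | tri< t<i _ _ =
  trans (cong (λ z → punchOutℕ (F i) (F z)) (punchInℕ-< i t t<i))
   (trans (punchOutℕ-consecutive (F i) (F (suc i)) consecutive (F t)
             (λ eq → <⇒≢ t<i (injective t i t<1+n i<1+n eq)) (λ eq → <⇒≢ (m<n⇒m<1+n t<i) (injective t (suc i) t<1+n i+1<1+n eq)))
          (cong (λ z → punchOutℕ (F (suc i)) (F z)) (sym (punchInℕ-< (suc i) t (m<n⇒m<1+n t<i)))))
  where t<1+n = m<n⇒m<1+n t<n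
        i<1+n = <-trans ≤-refl i+1<1+n
... | tri≈ _ refl _ =
  trans (cong (λ z → punchOutℕ (F i) (F z)) (punchInℕ-≥ i i ≤-refl))
   (trans (punchOutℕ-consecutive-swap (F i) (F (suc i)) consecutive)
          (cong (λ z → punchOutℕ (F (suc i)) (F z)) (sym (punchInℕ-< (suc i) i ≤-refl))))
... | tri> _ _ i<t =
  trans (cong (λ z → punchOutℕ (F i) (F z)) (punchInℕ-≥ i t (<⇒≤ i<t)))
   (trans (punchOutℕ-consecutive (F i) (F (suc i)) consecutive (F (suc t))
             (λ eq → <⇒≢ (m<n⇒m<1+n i<t) (sym (injective (suc t) i (s≤s t<n) i<1+n eq)))
             (λ eq → <⇒≢ (s≤s i<t) (sym (injective (suc t) (suc i) (s≤s t<n) i+1<1+n eq))))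
          (cong (λ z → punchOutℕ (F (suc i)) (F z)) (sym (punchInℕ-≥ (suc i) t i<t))))
  where i<1+n = <-trans ≤-refl i+1<1+n

equalChildren-at-left : ∀ n F i j → i < j → j < suc n → EqualBelow n (childℕ F i) (childℕ F j) →
  punchOutℕ (F i) (F (suc i)) ≡ punchOutℕ (F j) (F i)
equalChildren-at-left n F i j i<j j<1+n same =
  trans (cong (λ z → punchOutℕ (F i) (F z)) (sym (punchInℕ-≥ i i ≤-refl)))
    (trans (same i (<-≤-trans i<j (s≤s⁻¹ j<1+n))) (cong (λ z → punchOutℕ (F j) (F z)) (punchInℕ-< j i i<j)))

equalChildren⇒ascendingStep : ∀ n F i j → IsPermOn (suc n) F → i < j → j < suc n →
  EqualBelow n (childℕ F i) (childℕ F j) → F i < F j → F (suc i) ≡ suc (F i)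
equalChildren⇒ascendingStep n F i j (_ , injective) i<j j<1+n same Fi<Fj =
  punchOutℕ-≡-self (F i) (F (suc i)) (λ eq → 1+n≢n (injective _ _ (≤-<-trans i<j j<1+n) (<-trans i<j j<1+n) eq))
    (trans (equalChildren-at-left n F i j i<j j<1+n same) (punchOutℕ-< (F j) (F i) Fi<Fj))

equalChildren⇒descendingStep : ∀ n F i j → IsPermOn (suc n) F → i < j → j < suc n →
  EqualBelow n (childℕ F i) (childℕ F j) → F j < F i → suc (F (suc i)) ≡ F i
equalChildren⇒descendingStep n F i j (_ , injective) i<j j<1+n same Fj<Fi =
  punchOutℕ-≡-pred (F i) (F (suc i)) (λ eq → 1+n≢n (injective _ _ (≤-<-trans i<j j<1+n) (<-trans i<j j<1+n) eq))
    (trans (cong suc (equalChildren-at-left n F i j i<j j<1+n same)) (punchOutℕ-> (F j) (F i) Fj<Fi))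

equalChildren⇒ascendingRun : ∀ n F → IsPermOn (suc n) F → ∀ i j → i < j → j < suc n →
  EqualBelow n (childℕ F i) (childℕ F j) → F i < F j → ∀ t → i + t ≤ j → F (i + t) ≡ F i + t
equalChildren⇒ascendingRun n F isPerm i j i<j j<1+n same Fi<Fj zero _ =
  trans (cong F (+-identityʳ i)) (sym (+-identityʳ (F i)))
equalChildren⇒ascendingRun n F isPerm i j i<j j<1+n same Fi<Fj (suc zero) _ = begin
  F (i + 1)  ≡⟨ cong F (+-comm i 1) ⟩
  F (suc i)  ≡⟨ equalChildren⇒ascendingStep n F i j isPerm i<j j<1+n same Fi<Fj ⟩
  suc (F i)  ≡⟨ +-comm 1 (F i) ⟩
  F i + 1    ∎
equalChildren⇒ascendingRun n F isPerm@(_ , injective) i j i<j j<1+n same Fi<Fj (suc (suc t)) i+2+t≤j = begin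
  F (i + suc (suc t))  ≡⟨ cong F (+-suc i (suc t)) ⟩
  F (suc i + suc t)    ≡⟨ equalChildren⇒ascendingRun n F isPerm (suc i) j i+1<j j<1+n same′ Fi+1<Fj (suc t) i+1+t≤j ⟩
  F (suc i) + suc t    ≡⟨ cong (_+ suc t) step ⟩
  suc (F i) + suc t    ≡⟨ sym (+-suc (F i) (suc t)) ⟩
  F i + suc (suc t)    ∎
  where
  step : F (suc i) ≡ suc (F i)
  step = equalChildren⇒ascendingStep n F i j isPerm i<j j<1+n same Fi<Fj
  i+1+t≤j : suc i + suc t ≤ j
  i+1+t≤j = subst (_≤ j) (+-suc i (suc t)) i+2+t≤j
  i+1<j : suc i < j
  i+1<j = <-≤-trans (m<m+n (suc i) (s≤s z≤n)) i+1+t≤j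
  same′ : EqualBelow n (childℕ F (suc i)) (childℕ F j)
  same′ = EqualBelow-trans (EqualBelow-sym (childℕ-adjacent-consecutive n F i isPerm (<-trans i+1<j j<1+n) (inj₁ step))) same
  Fi+1<Fj : F (suc i) < F j
  Fi+1<Fj = ≤∧≢⇒< (subst (_≤ F j) (sym step) Fi<Fj) (λ eq → <⇒≢ i+1<j (injective _ _ (<-trans i+1<j j<1+n) j<1+n eq))

equalChildren⇒descendingRun : ∀ n F → IsPermOn (suc n) F → ∀ i j → i < j → j < suc n →
  EqualBelow n (childℕ F i) (childℕ F j) → F j < F i → ∀ t → i + t ≤ j → F (i + t) + t ≡ F i
equalChildren⇒descendingRun n F isPerm i j i<j j<1+n same Fj<Fi zero _ =
  trans (+-identityʳ _) (cong F (+-identityʳ i))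
equalChildren⇒descendingRun n F isPerm i j i<j j<1+n same Fj<Fi (suc zero) _ = begin
  F (i + 1) + 1  ≡⟨ +-comm (F (i + 1)) 1 ⟩
  suc (F (i + 1))  ≡⟨ cong (suc ∘ F) (+-comm i 1) ⟩
  suc (F (suc i))  ≡⟨ equalChildren⇒descendingStep n F i j isPerm i<j j<1+n same Fj<Fi ⟩
  F i            ∎
equalChildren⇒descendingRun n F isPerm@(_ , injective) i j i<j j<1+n same Fj<Fi (suc (suc t)) i+2+t≤j = begin
  F (i + suc (suc t)) + suc (suc t)  ≡⟨ cong (λ z → F z + suc (suc t)) (+-suc i (suc t)) ⟩
  F (suc i + suc t) + suc (suc t)    ≡⟨ +-suc (F (suc i + suc t)) (suc t) ⟩
  suc (F (suc i + suc t) + suc t)    ≡⟨ cong suc (equalChildren⇒descendingRun n F isPerm (suc i) j i+1<j j<1+n same′ Fj<Fi+1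
                                                                                 (suc t) i+1+t≤j) ⟩
  suc (F (suc i))                    ≡⟨ step ⟩
  F i                                ∎
  where
  step : suc (F (suc i)) ≡ F i
  step = equalChildren⇒descendingStep n F i j isPerm i<j j<1+n same Fj<Fi
  i+1+t≤j : suc i + suc t ≤ j
  i+1+t≤j = subst (_≤ j) (+-suc i (suc t)) i+2+t≤j
  i+1<j : suc i < j
  i+1<j = <-≤-trans (m<m+n (suc i) (s≤s z≤n)) i+1+t≤j
  same′ : EqualBelow n (childℕ F (suc i)) (childℕ F j)
  same′ = EqualBelow-trans (EqualBelow-sym (childℕ-adjacent-consecutive n F i isPerm (<-trans i+1<j j<1+n) (inj₂ (sym step)))) same
  Fj<Fi+1 : F j < F (suc i)
  Fj<Fi+1 = ≤∧≢⇒< (s≤s⁻¹ (subst (F j <_) (sym step) Fj<Fi))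
              (λ eq → <⇒≢ i+1<j (sym (injective _ _ j<1+n (<-trans i+1<j j<1+n) eq)))

-- The members of K⁽¹⁾

-- In one-line notation with values 1 … m these are m … 2 1, 2 3 … m 1 and m 1 2 … (m − 1).
IsDecreasing : ℕ → (ℕ → ℕ) → Set
IsDecreasing n F = ∀ t → t < suc n → F t + t ≡ n

IsIncreasingThenMin : ℕ → (ℕ → ℕ) → Set
IsIncreasingThenMin n F = (∀ t → t < n → F t ≡ suc t) × F n ≡ 0

IsMaxThenIncreasing : ℕ → (ℕ → ℕ) → Set
IsMaxThenIncreasing n F = F 0 ≡ n × (∀ t → t < n → F (suc t) ≡ t)

Shape : ℕ → (ℕ → ℕ) → Set
Shape n F = IsDecreasing n F ⊎ IsIncreasingThenMin n F ⊎ IsMaxThenIncreasing n F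

IsDecreasing-unique : ∀ {n c d} → IsDecreasing n c → IsDecreasing n d → EqualBelow (suc n) c d
IsDecreasing-unique {c = c} {d} c↓ d↓ t t<1+n = +-cancelʳ-≡ t (c t) (d t) (trans (c↓ t t<1+n) (sym (d↓ t t<1+n)))

IsIncreasingThenMin-unique : ∀ {n c d} → IsIncreasingThenMin n c → IsIncreasingThenMin n d → EqualBelow (suc n) c d
IsIncreasingThenMin-unique (c↑ , c-last) (d↑ , d-last) t t<1+n with m≤n⇒m<n∨m≡n (s≤s⁻¹ t<1+n)
... | inj₁ t<n  = trans (c↑ t t<n) (sym (d↑ t t<n))
... | inj₂ refl = trans c-last (sym d-last)

IsMaxThenIncreasing-unique : ∀ {n c d} → IsMaxThenIncreasing n c → IsMaxThenIncreasing n d → EqualBelow (suc n) c d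
IsMaxThenIncreasing-unique (c-first , c↑) (d-first , d↑) zero    _       = trans c-first (sym d-first)
IsMaxThenIncreasing-unique (c-first , c↑) (d-first , d↑) (suc t) t<1+n = trans (c↑ t (s≤s⁻¹ t<1+n)) (sym (d↑ t (s≤s⁻¹ t<1+n)))

m+n≤n⇒m≡0 : ∀ m n → m + n ≤ n → m ≡ 0
m+n≤n⇒m≡0 m n m+n≤n = n≤0⇒n≡0 (+-cancelʳ-≤ n m 0 m+n≤n)

≡0⊎≡1⊎≥2 : ∀ a → a ≡ 0 ⊎ a ≡ 1 ⊎ 2 ≤ a
≡0⊎≡1⊎≥2 zero          = inj₁ refl
≡0⊎≡1⊎≥2 (suc zero)    = inj₂ (inj₁ refl)
≡0⊎≡1⊎≥2 (suc (suc a)) = inj₂ (inj₂ (s≤s (s≤s z≤n)))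

module ShapeOfK1 (n₁ : ℕ) (F : ℕ → ℕ) (isPerm : IsPermOn (suc (suc n₁)) F)
                 (indecomposable : IndecomposableOn (suc (suc n₁)) F) (unique : AtMostOneIndecomposableChild (suc n₁) F) where
  n : ℕ
  n = suc n₁

  bounded = proj₁ isPerm
  injective = proj₂ isPerm

  IndChild : ℕ → Set
  IndChild x = IndecomposableOn n (childℕ F x)

  0<n : 0 < n
  0<n = s≤s z≤n

  F0≢0 : F 0 ≢ 0
  F0≢0 F0≡0 = indecomposable 1 (s≤s z≤n) (s≤s (s≤s z≤n)) λ { zero _ → subst (_< 1) (sym F0≡0) (s≤s z≤n) ; (suc j) (s≤s ()) }

  belowMax : ∀ p → p < suc n → F p ≡ n → ∀ l → l < suc n → l ≢ p → F l < n
  belowMax p p<1+n Fp≡n l l<1+n l≢p =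
    ≤∧≢⇒< (s≤s⁻¹ (bounded l l<1+n)) (λ eq → l≢p (injective l p l<1+n p<1+n (trans eq (sym Fp≡n))))

  aboveMin : ∀ r → r < suc n → F r ≡ 0 → ∀ l → l < suc n → l ≢ r → 0 < F l
  aboveMin r r<1+n Fr≡0 l l<1+n l≢r = n≢0⇒n>0 (λ eq → l≢r (injective l r l<1+n r<1+n (trans eq (sym Fr≡0))))

  crossing : ∀ k → 0 < k → k < suc n → DoubleNegation (Crossing (suc n) F k)
  crossing = indecomposable⇒¬¬crossing (suc n) F isPerm indecomposable

  -- If the child at 0 splits at k, every crossing of F at k + 1 starts at 0; then (1, r) crosses
  -- that split when k < r, and otherwise every crossing of F survives deleting the minimum.
  firstOrMinChild : ∀ r → r < suc n → F r ≡ 0 → ¬ IndChild 0 → ¬ IndChild r → ⊥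
  firstOrMinChild r r<1+n Fr≡0 ¬ind0 ¬indr = ¬ind0 λ k 0<k k<n splits → crossing (suc k) (s≤s z≤n) (s≤s k<n) λ
    { (suc j , l , j<1+k , k<l , l<1+n , Fl<Fj) →
        survivingCrossing⇒¬splitsAtℕ n F 0 isPerm (s≤s z≤n) k (cutAfter (suc j) l 0<k (s≤s⁻¹ j<1+k) k<l l<1+n (λ ()) Fl<Fj) splits
    ; (zero , l , _ , k<l , l<1+n , Fl<F0) → fromFirst k 0<k k<n splits l k<l l<1+n Fl<F0 }
    where
    fromFirst : ∀ k → 0 < k → k < n → SplitsAtℕ (childℕ F 0) k → ∀ l → k < l → l < suc n → F l < F 0 → ⊥
    fromFirst k 0<k k<n splits l k<l l<1+n Fl<F0 with k <? r
    ... | yes k<r = survivingCrossing⇒¬splitsAtℕ n F 0 isPerm (s≤s z≤n) k (cutAfter 1 r 0<k 0<k k<r r<1+n (λ ())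
           (subst (_< F 1) (sym Fr≡0) (aboveMin r r<1+n Fr≡0 1 (s≤s (s≤s z≤n)) (λ 1≡r → <⇒≱ k<r (subst (_≤ k) 1≡r 0<k)))))
           splits
    ... | no  k≮r = ¬indr (survivingCrossings⇒indecomposable n F r isPerm r<1+n survives)
      where
      r≤k : r ≤ k
      r≤k = ≮⇒≥ k≮r
      survives : ∀ k′ → 0 < k′ → k′ < n → DoubleNegation (SurvivingCrossing F (suc n) r k′)
      survives k′ 0<k′ k′<n = ¬¬survivingCrossing F (suc n) r k′
        (λ k′≤r none → none (cutBefore 0 l k′≤r 0<k′ (≤-trans k′≤r (≤-trans r≤k (<⇒≤ k<l))) l<1+n
                               (λ l≡r → <⇒≱ k<l (subst (_≤ k) (sym l≡r) r≤k)) Fl<F0))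
        (λ r<k′ none → crossing (suc k′) (s≤s z≤n) (s≤s k′<n) λ { (j , l′ , j<1+k′ , k′<l′ , l′<1+n , Fl′<Fj) →
            none (cutAfter j l′ r<k′ (s≤s⁻¹ j<1+k′) k′<l′ l′<1+n
                   (λ j≡r → <⇒≱ Fl′<Fj (subst (_≤ F l′) (sym (trans (cong F j≡r) Fr≡0)) z≤n)) Fl′<Fj) })

  -- Dually, if the child at n splits at k, every crossing of F at k ends at n.
  lastOrMaxChild : ∀ p → p < suc n → F p ≡ n → ¬ IndChild n → ¬ IndChild p → ⊥
  lastOrMaxChild p p<1+n Fp≡n ¬indn ¬indp = ¬indn λ k 0<k k<n splits → crossing k 0<k (<-trans k<n (n<1+n n)) λ
    { (j , l , j<k , k≤l , l<1+n , Fl<Fj) → fromCrossing k 0<k k<n splits j l j<k k≤l l<1+n Fl<Fj }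
    where
    fromCrossing : ∀ k → 0 < k → k < n → SplitsAtℕ (childℕ F n) k → ∀ j l → j < k → k ≤ l → l < suc n → F l < F j → ⊥
    fromCrossing k 0<k k<n splits j l j<k k≤l l<1+n Fl<Fj with l ≟ n
    ... | no l≢n = survivingCrossing⇒¬splitsAtℕ n F n isPerm (n<1+n n) k (cutBefore j l (<⇒≤ k<n) j<k k≤l l<1+n l≢n Fl<Fj) splits
    ... | yes refl with p <? k
    ...   | yes p<k = survivingCrossing⇒¬splitsAtℕ n F n isPerm (n<1+n n) k
              (cutBefore p k (<⇒≤ k<n) p<k ≤-refl (<-trans k<n (n<1+n n)) (<⇒≢ k<n)
                 (subst (F k <_) (sym Fp≡n) (belowMax p p<1+n Fp≡n k (<-trans k<n (n<1+n n)) (λ k≡p → <⇒≢ p<k (sym k≡p))))) splits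
    ...   | no  p≮k = ¬indp (survivingCrossings⇒indecomposable n F p isPerm p<1+n survives)
      where
      k≤p : k ≤ p
      k≤p = ≮⇒≥ p≮k
      survives : ∀ k′ → 0 < k′ → k′ < n → DoubleNegation (SurvivingCrossing F (suc n) p k′)
      survives k′ 0<k′ k′<n = ¬¬survivingCrossing F (suc n) p k′
        (λ k′≤p none → crossing k′ 0<k′ (<-trans k′<n (n<1+n n)) λ
          { (j′ , l′ , j′<k′ , k′≤l′ , l′<1+n , Fl′<Fj′) → none (cutBefore j′ l′ k′≤p j′<k′ k′≤l′ l′<1+n
              (λ l′≡p → <⇒≢ (<-≤-trans Fl′<Fj′ (s≤s⁻¹ (bounded j′ (<-trans (<-≤-trans j′<k′ k′≤l′) l′<1+n))))
                             (trans (cong F l′≡p) Fp≡n))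
              Fl′<Fj′) })
        (λ p<k′ none → none (cutAfter j n p<k′ (<⇒≤ (<-≤-trans j<k (≤-trans k≤p (<⇒≤ p<k′)))) k′<n (n<1+n n)
                              (λ j≡p → <⇒≱ j<k (subst (k ≤_) (sym j≡p) k≤p)) Fl<Fj))

  firstAndLastChildren⇒decreasing : IndChild 0 → IndChild n → IsDecreasing n F
  firstAndLastChildren⇒decreasing ind0 indn with <-cmp (F 0) (F n)
  ... | tri< F0<Fn _ _ = ⊥-elim (F0≢0 (m+n≤n⇒m≡0 (F 0) n (s≤s⁻¹ (subst (_< suc n)
          (equalChildren⇒ascendingRun n F isPerm 0 n 0<n (n<1+n n) same F0<Fn n ≤-refl) (bounded n (n<1+n n))))))
    where same = unique 0 n (s≤s z≤n) (n<1+n n) ind0 indn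
  ... | tri≈ _ F0≡Fn _ = ⊥-elim (<⇒≢ 0<n (injective 0 n (s≤s z≤n) (n<1+n n) F0≡Fn))
  ... | tri> _ _ Fn<F0 = λ t t<1+n → trans (run t (s≤s⁻¹ t<1+n)) F0≡n
    where
    run : ∀ t → t ≤ n → F t + t ≡ F 0
    run = equalChildren⇒descendingRun n F isPerm 0 n 0<n (n<1+n n) (unique 0 n (s≤s z≤n) (n<1+n n) ind0 indn) Fn<F0
    F0≡n : F 0 ≡ n
    F0≡n = ≤-antisym (s≤s⁻¹ (bounded 0 (s≤s z≤n))) (subst (n ≤_) (run n ≤-refl) (m≤n+m n (F n)))

  minAndMaxChildren⇒decreasing : ∀ r p → r < suc n → p < suc n → F r ≡ 0 → F p ≡ n → IndChild r → IndChild p → IsDecreasing n F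
  minAndMaxChildren⇒decreasing r p r<1+n p<1+n Fr≡0 Fp≡n indr indp with <-cmp r p
  ... | tri< r<p _ _ = ⊥-elim (F0≢0 (subst (λ z → F z ≡ 0) r≡0 Fr≡0))
    where
    d = proj₁ (m≤n⇒∃[o]m+o≡n (<⇒≤ r<p))
    r+d≡p : r + d ≡ p
    r+d≡p = proj₂ (m≤n⇒∃[o]m+o≡n (<⇒≤ r<p))
    n≡d : n ≡ d
    n≡d = begin
      n          ≡⟨ sym Fp≡n ⟩
      F p        ≡⟨ cong F (sym r+d≡p) ⟩
      F (r + d)  ≡⟨ equalChildren⇒ascendingRun n F isPerm r p r<p p<1+n (unique r p r<1+n p<1+n indr indp)
                      (subst₂ _<_ (sym Fr≡0) (sym Fp≡n) 0<n) d (≤-reflexive r+d≡p) ⟩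
      F r + d    ≡⟨ cong (_+ d) Fr≡0 ⟩
      d          ∎
    r≡0 : r ≡ 0
    r≡0 = m+n≤n⇒m≡0 r n (subst (λ z → r + z ≤ n) (sym n≡d) (subst (_≤ n) (sym r+d≡p) (s≤s⁻¹ p<1+n)))
  ... | tri≈ _ r≡p _ = ⊥-elim (<⇒≢ 0<n (trans (sym Fr≡0) (trans (cong F r≡p) Fp≡n)))
  ... | tri> _ _ p<r = λ t t<1+n → subst (λ z → F (z + t) + t ≡ n) p≡0
                         (trans (run t (≤-trans (+-monoʳ-≤ p (subst (t ≤_) n≡d (s≤s⁻¹ t<1+n))) (≤-reflexive p+d≡r))) Fp≡n)
    where
    d = proj₁ (m≤n⇒∃[o]m+o≡n (<⇒≤ p<r))
    p+d≡r : p + d ≡ r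
    p+d≡r = proj₂ (m≤n⇒∃[o]m+o≡n (<⇒≤ p<r))
    run : ∀ t → p + t ≤ r → F (p + t) + t ≡ F p
    run = equalChildren⇒descendingRun n F isPerm p r p<r r<1+n (EqualBelow-sym (unique r p r<1+n p<1+n indr indp))
            (subst₂ _<_ (sym Fr≡0) (sym Fp≡n) 0<n)
    n≡d : n ≡ d
    n≡d = begin
      n              ≡⟨ sym Fp≡n ⟩
      F p            ≡⟨ sym (run d (≤-reflexive p+d≡r)) ⟩
      F (p + d) + d  ≡⟨ cong (λ z → F z + d) p+d≡r ⟩
      F r + d        ≡⟨ cong (_+ d) Fr≡0 ⟩
      d              ∎
    p≡0 : p ≡ 0
    p≡0 = m+n≤n⇒m≡0 p n (subst (λ z → p + z ≤ n) (sym n≡d) (subst (_≤ n) (sym p+d≡r) (s≤s⁻¹ r<1+n)))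

  firstAndMaxChildren⇒increasingThenMin : ∀ p → p < suc n → F p ≡ n →
    IndChild 0 → IndChild p → ¬ IndChild n → IsIncreasingThenMin n F
  firstAndMaxChildren⇒increasingThenMin zero    _     Fp≡n _    _    ¬indn =
    ⊥-elim (¬indn (childℕ-indecomposable-topFirst n F n isPerm Fp≡n 0<n (n<1+n n)))
  firstAndMaxChildren⇒increasingThenMin (suc d) p<1+n Fp≡n ind0 indp ¬indn = byFirstValue (≡0⊎≡1⊎≥2 (F 0))
    where
    run : ∀ t → t ≤ suc d → F t ≡ F 0 + t
    run = equalChildren⇒ascendingRun n F isPerm 0 (suc d) (s≤s z≤n) p<1+n (unique 0 (suc d) (s≤s z≤n) p<1+n ind0 indp)
            (subst (F 0 <_) (sym Fp≡n) (belowMax (suc d) p<1+n Fp≡n 0 (s≤s z≤n) (λ ())))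
    F0+1+d≡n : F 0 + suc d ≡ n
    F0+1+d≡n = trans (sym (run (suc d) ≤-refl)) Fp≡n
    byFirstValue : F 0 ≡ 0 ⊎ F 0 ≡ 1 ⊎ 2 ≤ F 0 → IsIncreasingThenMin n F
    byFirstValue (inj₁ F0≡0) = ⊥-elim (F0≢0 F0≡0)
    byFirstValue (inj₂ (inj₁ F0≡1)) = increasing , lastIsMin (F n) refl
      where
      n≡2+d : n ≡ suc (suc d)
      n≡2+d = trans (sym F0+1+d≡n) (cong (_+ suc d) F0≡1)
      increasing : ∀ t → t < n → F t ≡ suc t
      increasing t t<n = trans (run t (s≤s⁻¹ (subst (t <_) n≡2+d t<n))) (cong (_+ t) F0≡1)
      lastIsMin : ∀ v → F n ≡ v → F n ≡ 0
      lastIsMin zero    Fn≡0 = Fn≡0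
      lastIsMin (suc s) Fn≡1+s = ⊥-elim (<⇒≢ s<n (injective s n (<-trans s<n (n<1+n n)) (n<1+n n) (trans (increasing s s<n) (sym Fn≡1+s))))
        where s<n : s < n
              s<n = s≤s⁻¹ (subst (_< suc n) Fn≡1+s (bounded n (n<1+n n)))
    byFirstValue (inj₂ (inj₂ 2≤F0)) = ⊥-elim (¬indn (survivingCrossings⇒indecomposable n F n isPerm (n<1+n n)
      λ k 0<k k<n none → none (cutBefore 0 n₁ (<⇒≤ k<n) 0<k (s≤s⁻¹ k<n) (<-trans ≤-refl (n<1+n n)) (<⇒≢ ≤-refl)
                                 (belowFirst n₁ 1+d<n₁ (<-trans ≤-refl (n<1+n n))))))
      where
      1+d<n₁ : suc d < n₁
      1+d<n₁ = s≤s⁻¹ (≤-trans (+-monoˡ-≤ (suc d) 2≤F0) (≤-reflexive F0+1+d≡n))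
      belowFirst : ∀ l → suc d < l → l < suc n → F l < F 0
      belowFirst l 1+d<l l<1+n with F 0 ≤? F l
      ... | no  F0≰Fl = ≰⇒> F0≰Fl
      ... | yes F0≤Fl = ⊥-elim (<⇒≱ 1+d<l (subst (_≤ suc d) s≡l s≤1+d))
        where
        s = F l ∸ F 0
        F0+s≡Fl : F 0 + s ≡ F l
        F0+s≡Fl = m+[n∸m]≡n F0≤Fl
        s≤1+d : s ≤ suc d
        s≤1+d = +-cancelˡ-≤ (F 0) s (suc d) (subst₂ _≤_ (sym F0+s≡Fl) (sym F0+1+d≡n) (s≤s⁻¹ (bounded l l<1+n)))
        s≡l : s ≡ l
        s≡l = injective s l (s≤s (≤-trans s≤1+d (<⇒≤ (<-trans 1+d<n₁ ≤-refl)))) l<1+n (trans (run s s≤1+d) F0+s≡Fl)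

  minAndLastChildren⇒maxThenIncreasing : ∀ r → r < suc n → F r ≡ 0 →
    IndChild r → IndChild n → ¬ IndChild 0 → IsMaxThenIncreasing n F
  minAndLastChildren⇒maxThenIncreasing r r<1+n Fr≡0 indr indn ¬ind0 with r ≟ n
  ... | yes refl = ⊥-elim (¬ind0 (childℕ-indecomposable-bottomLast n₁ F 0 isPerm Fr≡0 (s≤s z≤n)))
  ... | no  r≢n  = byMinPosition (≡0⊎≡1⊎≥2 r)
    where
    r<n : r < n
    r<n = ≤∧≢⇒< (s≤s⁻¹ r<1+n) r≢n
    run : ∀ t → r + t ≤ n → F (r + t) ≡ t
    run t r+t≤n = trans (equalChildren⇒ascendingRun n F isPerm r n r<n (n<1+n n) (unique r n r<1+n (n<1+n n) indr indn)
                          (subst (_< F n) (sym Fr≡0) (aboveMin r r<1+n Fr≡0 n (n<1+n n) (λ n≡r → r≢n (sym n≡r)))) t r+t≤n)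
                        (cong (_+ t) Fr≡0)
    byMinPosition : r ≡ 0 ⊎ r ≡ 1 ⊎ 2 ≤ r → IsMaxThenIncreasing n F
    byMinPosition (inj₁ r≡0) = ⊥-elim (F0≢0 (subst (λ z → F z ≡ 0) r≡0 Fr≡0))
    byMinPosition (inj₂ (inj₁ refl)) = F0≡n , increasing
      where
      increasing : ∀ t → t < n → F (suc t) ≡ t
      increasing = run
      F0≡n : F 0 ≡ n
      F0≡n with F 0 <? n
      ... | no  F0≮n = ≤-antisym (s≤s⁻¹ (bounded 0 (s≤s z≤n))) (≮⇒≥ F0≮n)
      ... | yes F0<n = ⊥-elim (1+n≢0 (injective (suc (F 0)) 0 (s≤s F0<n) (s≤s z≤n) (increasing (F 0) F0<n)))
    byMinPosition (inj₂ (inj₂ 2≤r)) = ⊥-elim (¬ind0 (survivingCrossings⇒indecomposable n F 0 isPerm (s≤s z≤n)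
      λ k 0<k k<n none → none (cutAfter 1 n 0<k 0<k k<n (n<1+n n) (λ ()) Fn<F1)))
      where
      d = proj₁ (m≤n⇒∃[o]m+o≡n (<⇒≤ r<n))
      r+d≡n : r + d ≡ n
      r+d≡n = proj₂ (m≤n⇒∃[o]m+o≡n (<⇒≤ r<n))
      Fn≡d : F n ≡ d
      Fn≡d = trans (cong F (sym r+d≡n)) (run d (≤-reflexive r+d≡n))
      Fn<F1 : F n < F 1
      Fn<F1 with F 1 ≤? d
      ... | no  F1≰d = subst (_< F 1) (sym Fn≡d) (≰⇒> F1≰d)
      ... | yes F1≤d = ⊥-elim (<⇒≱ (≤-trans 2≤r (m≤m+n r (F 1)))
                         (≤-reflexive (injective (r + F 1) 1 (s≤s r+F1≤n) (s≤s (s≤s z≤n)) (run (F 1) r+F1≤n))))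
        where r+F1≤n = ≤-trans (+-monoʳ-≤ r F1≤d) (≤-reflexive r+d≡n)

  shapeFromChildren : ∀ r p → r < suc n → p < suc n → F r ≡ 0 → F p ≡ n →
    Dec (IndChild 0) → Dec (IndChild r) → Dec (IndChild n) → Dec (IndChild p) → Shape n F
  shapeFromChildren r p r< p< Fr≡0 Fp≡n (yes ind0) _          (yes indn) _          = inj₁ (firstAndLastChildren⇒decreasing ind0 indn)
  shapeFromChildren r p r< p< Fr≡0 Fp≡n _          (yes indr) _          (yes indp) = inj₁ (minAndMaxChildren⇒decreasing r p r< p< Fr≡0 Fp≡n indr indp)
  shapeFromChildren r p r< p< Fr≡0 Fp≡n _          _          (no ¬indn) (no ¬indp) = ⊥-elim (lastOrMaxChild p p< Fp≡n ¬indn ¬indp)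
  shapeFromChildren r p r< p< Fr≡0 Fp≡n (no ¬ind0) (no ¬indr) _          _          = ⊥-elim (firstOrMinChild r r< Fr≡0 ¬ind0 ¬indr)
  shapeFromChildren r p r< p< Fr≡0 Fp≡n (yes ind0) (no _)     (no ¬indn) (yes indp) =
    inj₂ (inj₁ (firstAndMaxChildren⇒increasingThenMin p p< Fp≡n ind0 indp ¬indn))
  shapeFromChildren r p r< p< Fr≡0 Fp≡n (no ¬ind0) (yes indr) (yes indn) (no _)     =
    inj₂ (inj₂ (minAndLastChildren⇒maxThenIncreasing r r< Fr≡0 indr indn ¬ind0))

  shape : DoubleNegation (Shape n F)
  shape notShape = ¬¬-surjective n F isPerm 0 (s≤s z≤n) λ { (r , r<1+n , Fr≡0) →
                   ¬¬-surjective n F isPerm n (n<1+n n) λ { (p , p<1+n , Fp≡n) →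
    notShape (shapeFromChildren r p r<1+n p<1+n Fr≡0 Fp≡n (child? 0) (child? r) (child? n) (child? p)) } }
    where
    child? : ∀ x → Dec (IndChild x)
    child? x = indecomposableOn? n (childℕ F x)

atMostOneIndecomposableChild⇒shape : ∀ n₁ F → IsPermOn (suc (suc n₁)) F → IndecomposableOn (suc (suc n₁)) F →
  AtMostOneIndecomposableChild (suc n₁) F → DoubleNegation (Shape (suc n₁) F)
atMostOneIndecomposableChild⇒shape = ShapeOfK1.shape

-- Permutations whose indecomposable children lie in K⁽¹⁾

fresh-1-3 : ∀ a b → ∃ λ t → 0 < t × t ≤ 3 × t ≢ a × t ≢ b × (t ≤ 2 ⊎ a < t)
fresh-1-3 a b with 1 ≟ a | 1 ≟ b | 2 ≟ a | 2 ≟ b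
... | no 1≢a   | no 1≢b   | _        | _        = 1 , s≤s z≤n , s≤s z≤n , 1≢a , 1≢b , inj₁ (s≤s z≤n)
... | _        | _        | no 2≢a   | no 2≢b   = 2 , s≤s z≤n , s≤s (s≤s z≤n) , 2≢a , 2≢b , inj₁ ≤-refl
... | yes refl | _        | _        | yes refl = 3 , s≤s z≤n , ≤-refl , (λ ()) , (λ ()) , inj₂ (s≤s (s≤s z≤n))
... | _        | yes refl | yes refl | _        = 3 , s≤s z≤n , ≤-refl , (λ ()) , (λ ()) , inj₂ (s≤s (s≤s (s≤s z≤n)))
... | yes refl | _        | yes ()   | _
... | _        | yes refl | _        | yes ()

module ChildrenInK1 (k : ℕ) (F : ℕ → ℕ) (isPerm : IsPermOn (5 + k) F) (indecomposable : IndecomposableOn (5 + k) F)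
  (childrenInK1 : ∀ z → z < 5 + k → IndecomposableOn (4 + k) (childℕ F z) → AtMostOneIndecomposableChild (3 + k) (childℕ F z))
  where
  n′ n N : ℕ
  n′ = 3 + k
  n  = 4 + k
  N  = 5 + k

  childShape : ∀ z → z < N → IndecomposableOn n (childℕ F z) → DoubleNegation (Shape n′ (childℕ F z))
  childShape z z<N ind =
    atMostOneIndecomposableChild⇒shape (2 + k) (childℕ F z) (childℕ-isPerm n F z isPerm z<N) ind (childrenInK1 z z<N ind)

  childOrder⇒order : ∀ x {s u} → s ≢ x → u ≢ x → childℕ F x (punchOutℕ x s) < childℕ F x (punchOutℕ x u) → F s < F u
  childOrder⇒order x {s} {u} s≢x u≢x lt =
    punchOutℕ-cancel-< (F x) (subst₂ _<_ (childℕ-punchOutℕ F x s s≢x) (childℕ-punchOutℕ F x u u≢x) lt)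

  decreasingChild⇒descent : ∀ a → a < N → IsDecreasing n′ (childℕ F a) →
    ∀ {s u} → s < u → u < N → s ≢ a → u ≢ a → F u < F s
  decreasingChild⇒descent a a<N c↓ {s} {u} s<u u<N s≢a u≢a = childOrder⇒order a u≢a s≢a
    (+-cancelʳ-< (punchOutℕ a u) _ _ (subst (_< childℕ F a (punchOutℕ a s) + punchOutℕ a u)
       (trans (c↓ _ (position (<-trans s<u u<N) s≢a)) (sym (c↓ _ (position u<N u≢a))))
       (+-monoʳ-< _ (punchOutℕ-mono-< a s≢a u≢a s<u))))
    where
    position : ∀ {t} → t < N → t ≢ a → punchOutℕ a t < n
    position {t} t<N t≢a = punchOutℕ-bounded n a t a<N t<N t≢a

  IncreasingTriple : Set
  IncreasingTriple = ∃ λ p → ∃ λ q → ∃ λ r → p < q × q < r × r < N × F p < F q × F q < F r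

  childTriple⇒triple : ∀ b {w₀ w₁ w₂} → w₀ < w₁ → w₁ < w₂ → w₂ < n →
    childℕ F b w₀ < childℕ F b w₁ → childℕ F b w₁ < childℕ F b w₂ → IncreasingTriple
  childTriple⇒triple b w₀<w₁ w₁<w₂ w₂<n lt₀₁ lt₁₂ =
    punchInℕ b _ , punchInℕ b _ , punchInℕ b _ , punchInℕ-mono-< b w₀<w₁ , punchInℕ-mono-< b w₁<w₂ ,
    s≤s (≤-trans (punchInℕ-≤ b _) w₂<n) , punchOutℕ-cancel-< (F b) lt₀₁ , punchOutℕ-cancel-< (F b) lt₁₂

  increasingThenMin⇒triple : ∀ b → IsIncreasingThenMin n′ (childℕ F b) → IncreasingTriple
  increasingThenMin⇒triple b (c↑ , _) = childTriple⇒triple b {0} {1} {2} (s≤s z≤n) ≤-refl (s≤s (s≤s (s≤s z≤n)))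
    (subst₂ _<_ (sym (c↑ 0 (s≤s z≤n))) (sym (c↑ 1 (s≤s (s≤s z≤n)))) ≤-refl)
    (subst₂ _<_ (sym (c↑ 1 (s≤s (s≤s z≤n)))) (sym (c↑ 2 (s≤s (s≤s (s≤s z≤n))))) ≤-refl)

  maxThenIncreasing⇒triple : ∀ b → IsMaxThenIncreasing n′ (childℕ F b) → IncreasingTriple
  maxThenIncreasing⇒triple b (_ , c↑) = childTriple⇒triple b {1} {2} {3} ≤-refl ≤-refl (s≤s (s≤s (s≤s (s≤s z≤n))))
    (subst₂ _<_ (sym (c↑ 0 (s≤s z≤n))) (sym (c↑ 1 (s≤s (s≤s z≤n)))) ≤-refl)
    (subst₂ _<_ (sym (c↑ 1 (s≤s (s≤s z≤n)))) (sym (c↑ 2 (s≤s (s≤s (s≤s z≤n))))) ≤-refl)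

  decreasingChild⇒¬triple : ∀ a → a < N → IsDecreasing n′ (childℕ F a) → ¬ IncreasingTriple
  decreasingChild⇒¬triple a a<N c↓ (p , q , r , p<q , q<r , r<N , Fp<Fq , Fq<Fr) with p ≟ a | q ≟ a
  ... | yes refl | _ = <-asym (descent q<r r<N (>⇒≢ p<q) (>⇒≢ (<-trans p<q q<r))) Fq<Fr
    where descent = decreasingChild⇒descent a a<N c↓
  ... | no p≢a | yes refl = <-asym (decreasingChild⇒descent a a<N c↓ (<-trans p<q q<r) r<N p≢a (>⇒≢ q<r)) (<-trans Fp<Fq Fq<Fr)
  ... | no p≢a | no q≢a = <-asym (decreasingChild⇒descent a a<N c↓ p<q (<-trans q<r r<N) p≢a q≢a) Fp<Fq

  increasingThenMin-rising : ∀ a → IsIncreasingThenMin n′ (childℕ F a) → ∀ {s u} → s < u → s ≢ a → u ≢ a →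
    punchOutℕ a u < n′ → F s < F u
  increasingThenMin-rising a (c↑ , _) s<u s≢a u≢a u′<n′ = childOrder⇒order a s≢a u≢a
    (subst₂ _<_ (sym (c↑ _ (<-trans s′<u′ u′<n′))) (sym (c↑ _ u′<n′)) (s≤s s′<u′))
    where s′<u′ = punchOutℕ-mono-< a s≢a u≢a s<u

  increasingThenMin-last : ∀ a → IsIncreasingThenMin n′ (childℕ F a) → ∀ {s u} → s ≢ a → u ≢ a →
    punchOutℕ a s < n′ → punchOutℕ a u ≡ n′ → F u < F s
  increasingThenMin-last a (c↑ , c-last) s≢a u≢a s′<n′ u′≡n′ = childOrder⇒order a u≢a s≢a
    (subst₂ _<_ (sym (trans (cong (childℕ F a) u′≡n′) c-last)) (sym (c↑ _ s′<n′)) (s≤s z≤n))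

  maxThenIncreasing-value : ∀ b → IsMaxThenIncreasing n′ (childℕ F b) → ∀ w → 0 < w → w < n → suc (childℕ F b w) ≡ w
  maxThenIncreasing-value b (_ , c↑) (suc w) _ w<n = cong suc (c↑ w (s≤s⁻¹ w<n))

  maxThenIncreasing-rising : ∀ b → b < N → IsMaxThenIncreasing n′ (childℕ F b) → ∀ {s u} → s < u → u < N → s ≢ b → u ≢ b →
    0 < punchOutℕ b s → F s < F u
  maxThenIncreasing-rising b b<N c′ s<u u<N s≢b u≢b 0<s′ = childOrder⇒order b s≢b u≢b
    (s≤s⁻¹ (subst₂ _<_ (sym (maxThenIncreasing-value b c′ _ 0<s′ (position (<-trans s<u u<N) s≢b)))
                       (sym (maxThenIncreasing-value b c′ _ (<-trans 0<s′ s′<u′) (position u<N u≢b))) s′<u′))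
    where
    s′<u′ = punchOutℕ-mono-< b s≢b u≢b s<u
    position : ∀ {t} → t < N → t ≢ b → punchOutℕ b t < n
    position {t} t<N t≢b = punchOutℕ-bounded n b t b<N t<N t≢b

  maxThenIncreasing-first : ∀ b → b < N → IsMaxThenIncreasing n′ (childℕ F b) → ∀ {s u} → s < N → s ≢ b → u ≢ b →
    0 < punchOutℕ b s → punchOutℕ b u ≡ 0 → F s < F u
  maxThenIncreasing-first b b<N c′ {s} s<N s≢b u≢b 0<s′ u′≡0 = childOrder⇒order b s≢b u≢b
    (subst (childℕ F b (punchOutℕ b s) <_) (sym (trans (cong (childℕ F b) u′≡0) (proj₁ c′)))
       (s≤s⁻¹ (subst (_< n) (sym (maxThenIncreasing-value b c′ _ 0<s′ s′<n)) s′<n)))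
    where
    s′<n = punchOutℕ-bounded n b s b<N s<N s≢b

  increasingThenMin-first-maxThenIncreasing⇒last : ∀ b → b < N → 0 ≢ b →
    IsIncreasingThenMin n′ (childℕ F 0) → IsMaxThenIncreasing n′ (childℕ F b) → b ≡ n
  increasingThenMin-first-maxThenIncreasing⇒last zero    _   0≢b _ _ = ⊥-elim (0≢b refl)
  increasingThenMin-first-maxThenIncreasing⇒last (suc b) b<N _   c c′ with suc b ≟ n
  ... | yes b≡n = b≡n
  ... | no  b≢n = ⊥-elim (byLast b refl)
    where
    viaLast : ∀ t → t ≤ 1 → suc t ≢ suc b → ⊥
    viaLast t t≤1 t≢b = <-asym
      (increasingThenMin-last 0 c {suc t} {n} (λ ()) (λ ()) (≤-<-trans t≤1 (s≤s (s≤s z≤n))) refl)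
      (maxThenIncreasing-rising (suc b) b<N c′ {suc t} {n} (s≤s (s≤s (≤-trans t≤1 (s≤s z≤n)))) ≤-refl t≢b (b≢n ∘ sym)
        (punchOutℕ-positive (suc b) (suc t) (s≤s z≤n) (s≤s z≤n) t≢b))
    byLast : ∀ b′ → b′ ≡ b → ⊥
    byLast zero    refl = viaLast 1 ≤-refl (λ ())
    byLast (suc _) refl = viaLast 0 z≤n (λ ())

  increasingThenMin-notFirst-maxThenIncreasing⇒⊥ : ∀ a b → b < N →
    IsIncreasingThenMin n′ (childℕ F (suc a)) → IsMaxThenIncreasing n′ (childℕ F b) → ⊥
  increasingThenMin-notFirst-maxThenIncreasing⇒⊥ zero zero b<N c c′ = <-asym
    (increasingThenMin-last 1 c {2} {n} (λ ()) (λ ()) (s≤s (s≤s z≤n)) refl)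
    (maxThenIncreasing-rising 0 b<N c′ {2} {n} (s≤s (s≤s (s≤s z≤n))) ≤-refl (λ ()) (λ ()) (s≤s z≤n))
  increasingThenMin-notFirst-maxThenIncreasing⇒⊥ (suc a) zero b<N c c′ = byPosition a refl
    where
    viaFirst : ∀ t → 1 < t → t ≢ suc (suc a) → punchOutℕ (suc (suc a)) t < n′ → t < N → ⊥
    viaFirst (suc t) 1<t t≢a t′<n′ t<N = <-asym
      (increasingThenMin-rising (suc (suc a)) c {1} {suc t} 1<t (λ ()) t≢a t′<n′)
      (maxThenIncreasing-first 0 b<N c′ {suc t} {1} t<N (λ ()) (λ ()) (s≤s⁻¹ 1<t) refl)
    byPosition : ∀ a′ → a′ ≡ a → ⊥
    byPosition zero    refl = viaFirst 3 (s≤s (s≤s z≤n)) (λ ()) (s≤s (s≤s (s≤s z≤n))) (s≤s (s≤s (s≤s (s≤s z≤n))))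
    byPosition (suc _) refl = viaFirst 2 ≤-refl (λ ()) (s≤s (s≤s (s≤s z≤n))) (s≤s (s≤s (s≤s z≤n)))
  increasingThenMin-notFirst-maxThenIncreasing⇒⊥ a (suc b) b<N c c′ with fresh-1-3 (suc a) (suc b)
  ... | t , 0<t , t≤3 , t≢a , t≢b , t≤2⊎a<t = <-asym
    (increasingThenMin-rising (suc a) c {0} {t} 0<t (λ ()) t≢a t′<n′)
    (maxThenIncreasing-first (suc b) b<N c′ {t} {0} (≤-<-trans t≤3 (s≤s (s≤s (s≤s (s≤s z≤n))))) t≢b (λ ())
      (punchOutℕ-positive (suc b) t (s≤s z≤n) 0<t t≢b) refl)
    where
    bound : t ≤ 2 ⊎ suc a < t → punchOutℕ (suc a) t < n′
    bound (inj₁ t≤2) = ≤-<-trans (≤-trans (punchOutℕ-≤ (suc a) t) t≤2) (s≤s (s≤s (s≤s z≤n)))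
    bound (inj₂ a<t) = <-≤-trans (subst (_≤ 3) (sym (punchOutℕ-> (suc a) t a<t)) t≤3) (s≤s (s≤s (s≤s z≤n)))
    t′<n′ = bound t≤2⊎a<t

  -- Here F is n 1 2 … (n − 1) 0, whose child at position 1 is sum indecomposable but of no Shape.
  increasingThenMin-first-maxThenIncreasing-last⇒⊥ : IsIncreasingThenMin n′ (childℕ F 0) → IsMaxThenIncreasing n′ (childℕ F n) → ⊥
  increasingThenMin-first-maxThenIncreasing-last⇒⊥ c c′ = childShape 1 (s≤s (s≤s z≤n)) indecomposable₁ λ
    { (inj₁ c↓) → <-asym (decreasingChild⇒descent 1 (s≤s (s≤s z≤n)) c↓ {2} {3} ≤-refl (s≤s (s≤s (s≤s (s≤s z≤n)))) (λ ()) (λ ()))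
                        (rising 2 3 (s≤s z≤n) ≤-refl (s≤s (s≤s (s≤s (s≤s z≤n)))))
    ; (inj₂ (inj₁ c₁)) → <-asym (increasingThenMin-rising 1 c₁ {0} {2} (s≤s z≤n) (λ ()) (λ ()) (s≤s (s≤s z≤n)))
                               (belowFirst 2 (s≤s z≤n) 2<n)
    ; (inj₂ (inj₂ c₁′)) → <-asym (maxThenIncreasing-rising 1 (s≤s (s≤s z≤n)) c₁′ {n′} {n} ≤-refl ≤-refl (λ ()) (λ ()) (s≤s z≤n))
                                (aboveLast n′ (s≤s z≤n) ≤-refl) }
    where
    2<n : 2 < n
    2<n = s≤s (s≤s (s≤s z≤n))
    aboveLast : ∀ t → 0 < t → t < n → F n < F t
    aboveLast (suc t) _ t<n = increasingThenMin-last 0 c {suc t} {n} (λ ()) (λ ()) (s≤s⁻¹ t<n) refl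
    rising : ∀ s u → 0 < s → s < u → u < n → F s < F u
    rising (suc s) (suc u) _ s<u u<n = increasingThenMin-rising 0 c {suc s} {suc u} s<u (λ ()) (λ ()) (s≤s⁻¹ u<n)
    belowFirst : ∀ t → 0 < t → t < n → F t < F 0
    belowFirst t 0<t t<n = maxThenIncreasing-first n ≤-refl c′ {t} {0} (<-trans t<n ≤-refl) (<⇒≢ t<n) (λ ())
      (subst (0 <_) (sym (punchOutℕ-< n t t<n)) 0<t) refl
    indecomposable₁ : IndecomposableOn n (childℕ F 1)
    indecomposable₁ = survivingCrossings⇒indecomposable n F 1 isPerm (s≤s (s≤s z≤n)) λ k′ 0<k′ k′<n →
      ¬¬survivingCrossing F N 1 k′
        (λ k′≤1 none → none (cutBefore 0 2 k′≤1 0<k′ (≤-trans k′≤1 (s≤s z≤n)) (s≤s (s≤s (s≤s z≤n))) (λ ())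
                               (belowFirst 2 (s≤s z≤n) 2<n)))
        (λ 1<k′ none → none (cutAfter 0 n 1<k′ z≤n k′<n ≤-refl (λ ())
                               (<-trans (aboveLast 2 (s≤s z≤n) 2<n) (belowFirst 2 (s≤s z≤n) 2<n))))

  increasingThenMin-maxThenIncreasing⇒⊥ : ∀ a b → b < N → a ≢ b →
    IsIncreasingThenMin n′ (childℕ F a) → IsMaxThenIncreasing n′ (childℕ F b) → ⊥
  increasingThenMin-maxThenIncreasing⇒⊥ zero b b<N a≢b c c′
    with increasingThenMin-first-maxThenIncreasing⇒last b b<N a≢b c c′
  ... | refl = increasingThenMin-first-maxThenIncreasing-last⇒⊥ c c′
  increasingThenMin-maxThenIncreasing⇒⊥ (suc a) b b<N _ c c′ = increasingThenMin-notFirst-maxThenIncreasing⇒⊥ a b b<N c c′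

  shapes-agree : ∀ x y → x < N → y < N → Shape n′ (childℕ F x) → Shape n′ (childℕ F y) →
    EqualBelow n (childℕ F x) (childℕ F y)
  shapes-agree x y x<N y<N shapeX shapeY with x ≟ y
  ... | yes refl = λ _ _ → refl
  ... | no  x≢y  = agree shapeX shapeY
    where
    agree : Shape n′ (childℕ F x) → Shape n′ (childℕ F y) → EqualBelow n (childℕ F x) (childℕ F y)
    agree (inj₁ x↓)        (inj₁ y↓)        = IsDecreasing-unique x↓ y↓
    agree (inj₁ x↓)        (inj₂ (inj₁ y↑)) = ⊥-elim (decreasingChild⇒¬triple x x<N x↓ (increasingThenMin⇒triple y y↑))
    agree (inj₁ x↓)        (inj₂ (inj₂ y↑)) = ⊥-elim (decreasingChild⇒¬triple x x<N x↓ (maxThenIncreasing⇒triple y y↑))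
    agree (inj₂ (inj₁ x↑)) (inj₁ y↓)        = ⊥-elim (decreasingChild⇒¬triple y y<N y↓ (increasingThenMin⇒triple x x↑))
    agree (inj₂ (inj₂ x↑)) (inj₁ y↓)        = ⊥-elim (decreasingChild⇒¬triple y y<N y↓ (maxThenIncreasing⇒triple x x↑))
    agree (inj₂ (inj₁ x↑)) (inj₂ (inj₁ y↑)) = IsIncreasingThenMin-unique x↑ y↑
    agree (inj₂ (inj₂ x↑)) (inj₂ (inj₂ y↑)) = IsMaxThenIncreasing-unique x↑ y↑
    agree (inj₂ (inj₁ x↑)) (inj₂ (inj₂ y↑)) = ⊥-elim (increasingThenMin-maxThenIncreasing⇒⊥ x y y<N x≢y x↑ y↑)
    agree (inj₂ (inj₂ x↑)) (inj₂ (inj₁ y↑)) = ⊥-elim (increasingThenMin-maxThenIncreasing⇒⊥ y x x<N (x≢y ∘ sym) y↑ x↑)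

  atMostOneIndecomposableChild : AtMostOneIndecomposableChild n F
  atMostOneIndecomposableChild x y x<N y<N indX indY =
    decidable-stable (equalBelow? n (childℕ F x) (childℕ F y)) λ differ →
      childShape x x<N indX λ shapeX → childShape y y<N indY λ shapeY → differ (shapes-agree x y x<N y<N shapeX shapeY)

indecomposableChildrenInK1⇒inK1 : ∀ k (π : Perm (5 + k)) → SumIndecomposable π →
  (∀ i → SumIndecomposable (child π i) → InK1 (child π i)) → InK1 π
indecomposableChildrenInK1⇒inK1 k π ind childrenInK1 = ind , AtMostOneIndecomposableChild⇒AtMostOneK π
  (ChildrenInK1.atMostOneIndecomposableChild k (entries π) (entries-isPerm π) (SumIndecomposable⇒IndecomposableOn π ind) childInK1)
  where
  childInK1 : ∀ z → z < 5 + k → IndecomposableOn (4 + k) (childℕ (entries π) z) →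
    AtMostOneIndecomposableChild (3 + k) (childℕ (entries π) z)
  childInK1 z z<N indz =
    AtMostOneIndecomposableChild-cong same (AtMostOneK⇒AtMostOneIndecomposableChild (child π i) (proj₂ (childrenInK1 i indᵢ)))
    where
    i = fromℕ< z<N
    same = entries-child-fromℕ< π z z<N
    indᵢ = IndecomposableOn⇒SumIndecomposable (child π i) (s≤s z≤n) (IndecomposableOn-cong (EqualBelow-sym same) indz)

proposition5p2 : (n : ℕ) (π : Perm (suc n)) → 5 ≤ suc n → SumIndecomposable π → ¬ InK1 π →
    ∃ λ (i : Fin (suc n)) → SumIndecomposable (child π i) × ¬ InK1 (child π i)
proposition5p2 zero                      π (s≤s ())
proposition5p2 (suc zero)                π (s≤s (s≤s ()))
proposition5p2 (suc (suc zero))          π (s≤s (s≤s (s≤s ())))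
proposition5p2 (suc (suc (suc zero)))    π (s≤s (s≤s (s≤s (s≤s ()))))
proposition5p2 (suc (suc (suc (suc k)))) π _ ind notInK1 =
  decidable-stable (any? λ i → sumIndecomposable? (child π i) ×-dec ¬? (inK1? (child π i))) λ none →
    notInK1 (indecomposableChildrenInK1⇒inK1 k π ind λ i indᵢ →
      decidable-stable (inK1? (child π i)) λ notInK1ᵢ → none (i , indᵢ , notInK1ᵢ))
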